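{- Let $R$ be a finite ring (associative, with nonzero identity), and let $J(R)$ denote its Jacobson radical. Then the unit graph $\Gamma'(R)$ of $R$ is well-covered if and only if the unitary Cayley graph $\Gamma(R)$ of $R$ is well-covered and $\operatorname{char}(R/J(R))=2$.
   Context: All rings are finite, associative, with nonzero identity; $U(R)$ is the set of units of $R$. The unit graph $\Gamma'(R)$ has vertex set $R$, two distinct vertices $x,y$ adjacent iff $x+y\in U(R)$. The unitary Cayley graph $\Gamma(R)$ has vertex set $R$, two distinct vertices $x,y$ adjacent iff $x-y\in U(R)$. A graph is well-covered if all its maximal independent sets have the same size. -}

module Defs where

open import Level using (0ℓ)
open import Data.Nat using (ℕ)
open import Data.Fin using (Fin)
open import Data.Fin.Subset using (Subset; _∈_; _∉_; _⊆_; ∣_∣)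
open import Data.Product using (Σ; ∃; _×_; _,_)
open import Relation.Binary.PropositionalEquality using (_≡_; _≢_)
open import Relation.Nullary using (¬_)
open import Algebra.Core using (Op₁; Op₂)
open import Algebra.Structures using (IsRing)

-- A finite ring (associative, with identity 1 ≠ 0).  Every finite ring is
-- isomorphic to one whose underlying set is Fin n, so we take the carrier
-- to be Fin n with propositional equality.
record FiniteRing : Set where
  field
    size    : ℕ
    _+_     : Op₂ (Fin size)
    _*_     : Op₂ (Fin size)
    -_      : Op₁ (Fin size)
    0#      : Fin size
    1#      : Fin size
    isRing  : IsRing {A = Fin size} _≡_ _+_ _*_ -_ 0# 1#
    1≢0     : 1# ≢ 0#

module _ (R : FiniteRing) where
  open FiniteRing R

  Elem : Set
  Elem = Fin size

  IsUnit : Elem → Set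
  IsUnit x = Σ Elem λ y → (x * y ≡ 1#) × (y * x ≡ 1#)

  IsLeftIdeal : Subset size → Set
  IsLeftIdeal I =
    (0# ∈ I) ×
    ((∀ x y → x ∈ I → y ∈ I → (x + y) ∈ I) ×
     (∀ r x → x ∈ I → (r * x) ∈ I))

  IsMaximalLeftIdeal : Subset size → Set
  IsMaximalLeftIdeal M =
    IsLeftIdeal M × ((1# ∉ M) ×
      (∀ I → IsLeftIdeal I → M ⊆ I → 1# ∉ I → I ⊆ M))

  InJacobson : Elem → Set
  InJacobson x = ∀ M → IsMaximalLeftIdeal M → x ∈ M

  -- char(R/J(R)) = 2 : 1+1 ∈ J(R) and 1 ∉ J(R) (R/J(R) has 1 ≠ 0)
  CharRmodJIs2 : Set
  CharRmodJIs2 = InJacobson (1# + 1#) × ¬ InJacobson 1#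

  UnitGraphAdj : Elem → Elem → Set
  UnitGraphAdj x y = (x ≢ y) × IsUnit (x + y)

  CayleyAdj : Elem → Elem → Set
  CayleyAdj x y = (x ≢ y) × IsUnit (x + (- y))

module _ {n : ℕ} (Adj : Fin n → Fin n → Set) where

  IsIndependent : Subset n → Set
  IsIndependent S = ∀ x y → x ∈ S → y ∈ S → ¬ Adj x y

  IsMaximalIndependent : Subset n → Set
  IsMaximalIndependent S =
    IsIndependent S × (∀ T → IsIndependent T → S ⊆ T → T ⊆ S)

  WellCovered : Set
  WellCovered = ∀ S T → IsMaximalIndependent S → IsMaximalIndependent T → ∣ S ∣ ≡ ∣ T ∣

{-# OPTIONS --safe #-}
module Submission where

-- If 2 ∈ J(R), then x + y and x − y = (x + y) − 2y are units together, so Γ′(R) and Γ(R) are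
-- the same graph; and 1 ∉ J(R) always.  Conversely, let Γ′(R) be well-covered and let
-- e = 2^(N+1) be an idempotent power of 2; it is central.
--   e = 0: 2 is central and nilpotent, hence in J(R).
--   e = 1: 2 is a unit, so negation fixes only 0 and pairs off the other vertices of a
--     negation-invariant maximal independent set, whose size is thus odd iff it contains 0.
--     Such sets through 0 and through 1 (a neighbour of 0) have sizes of different parity.
--   otherwise R ≅ eR × fR with f = 1 − e, 2 invertible on eR and nilpotent on fR.  For suitable
--     maximal K ⊆ eR and L ⊆ fR, the preimages of K under x ↦ e x and of L under x ↦ f x are
--     maximal independent sets of sizes ∣K∣ ∣fR∣ and ∣L∣ ∣eR∣.  As ∣fR∣ is a power of 2 and
--     ∣eR∣ is odd, ∣eR∣ divides ∣K∣, although 0 < ∣K∣ < ∣eR∣.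

open import Defs
open import Data.Product using (_×_; _,_)
open import Function.Bundles using (_⇔_; mk⇔; Equivalence)

module FiniteSubsets where

  open import Level using (Level)
  open import Data.Bool.Base using (Bool; true; false; if_then_else_)
  open import Data.Empty using (⊥-elim)
  open import Data.Fin.Base using (Fin; zero; suc; _<_)
  open import Data.Fin.Properties using (<-cmp; <-asym; <-irrefl) renaming (_≟_ to _≟ᶠ_; _<?_ to _<ᶠ?_)
  open import Data.Fin.Permutation using (Permutation; permutation; _⟨$⟩ʳ_)
  open import Data.Fin.Subset
    using (Subset; _∈_; _∉_; _⊆_; _∪_; _∩_; ⁅_⁆; ∣_∣; inside; outside) renaming (⊥ to ∅)
  open import Data.Fin.Subset.Properties
    using (_∈?_; ⊆-antisym; x∈p∪q⁻; x∈p∪q⁺; x∈p∩q⁻; x∈p∩q⁺; x∈⁅x⁆; x∈⁅y⁆⇒x≡y; ∉⊥; ∣⁅x⁆∣≡1; ∣⊥∣≡0;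
           p⊂q⇒∣p∣<∣q∣; ∣p∣≤n)
  open import Data.Nat.Base as ℕ using (ℕ; _+_; _*_; _∸_)
  open import Data.Nat.Induction using (<-wellFounded)
  open import Data.Nat.Properties using (+-suc; *-zeroʳ; *-identityʳ; +-identityʳ; ∸-monoʳ-<; +-*-semiring)
  open import Data.Product using (∃; proj₁; proj₂)
  open import Data.Sum using (inj₁; inj₂)
  open import Data.Vec.Base using ([]; _∷_; lookup; tabulate; here; there)
  open import Data.Vec.Properties using (lookup∘tabulate; []=⇒lookup; lookup⇒[]=; lookup-replicate)
  open import Function.Base using (_∘_)
  open import Induction.WellFounded using (Acc; acc)
  open import Relation.Binary.Definitions using (tri<; tri≈; tri>)
  open import Relation.Binary.PropositionalEquality
  open import Relation.Nullary using (¬_; yes; no; does)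
  open import Relation.Nullary.Decidable using (dec-true)
  open import Relation.Unary using (Pred; Decidable)
  open import Algebra.Properties.Semiring.Sum +-*-semiring
    using (sum; sum-cong-≗; ∑-comm; sum-permute; *-distribˡ-sum; *-distribʳ-sum; sum-replicate-zero)
  open ≡-Reasoning

  private
    variable
      ℓ : Level
      m n : ℕ
      x : Fin n
      p q : Subset n

  ∈-tabulate⁺ : ∀ {b : Fin n → Bool} → b x ≡ true → x ∈ tabulate b
  ∈-tabulate⁺ {x = x} {b} bx = lookup⇒[]= x (tabulate b) (trans (lookup∘tabulate b x) bx)

  ∈-tabulate⁻ : ∀ {b : Fin n → Bool} → x ∈ tabulate b → b x ≡ true
  ∈-tabulate⁻ {x = x} {b} x∈ = trans (sym (lookup∘tabulate b x)) ([]=⇒lookup x∈)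

  ⟦_⟧ : {P : Pred (Fin n) ℓ} → Decidable P → Subset n
  ⟦ P? ⟧ = tabulate (does ∘ P?)

  module _ {P : Pred (Fin n) ℓ} (P? : Decidable P) where

    ∈⟦⟧⁺ : P x → x ∈ ⟦ P? ⟧
    ∈⟦⟧⁺ {x} px = ∈-tabulate⁺ (dec-true (P? x) px)

    ∈⟦⟧⁻ : x ∈ ⟦ P? ⟧ → P x
    ∈⟦⟧⁻ {x} x∈ with P? x | ∈-tabulate⁻ {b = does ∘ P?} x∈
    ... | yes px | _ = px

  preimage : (Fin m → Fin n) → Subset n → Subset m
  preimage f p = tabulate (lookup p ∘ f)

  module _ {f : Fin m → Fin n} {x : Fin m} where

    ∈-preimage⁺ : f x ∈ p → x ∈ preimage f p
    ∈-preimage⁺ fx∈p = ∈-tabulate⁺ ([]=⇒lookup fx∈p)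

    ∈-preimage⁻ : x ∈ preimage f p → f x ∈ p
    ∈-preimage⁻ {p = p} x∈ = lookup⇒[]= (f x) p (∈-tabulate⁻ x∈)

  private
    drop-disjoint : ∀ {s t} → (∀ {x} → x ∈ s ∷ p → x ∉ t ∷ q) → ∀ {x} → x ∈ p → x ∉ q
    drop-disjoint disjoint x∈p x∈q = disjoint (there x∈p) (there x∈q)

  ∣p∪q∣≡∣p∣+∣q∣ : (∀ {x} → x ∈ p → x ∉ q) → ∣ p ∪ q ∣ ≡ ∣ p ∣ + ∣ q ∣
  ∣p∪q∣≡∣p∣+∣q∣ {p = []}          {[]}          _        = refl
  ∣p∪q∣≡∣p∣+∣q∣ {p = inside ∷ p}  {inside ∷ q}  disjoint = ⊥-elim (disjoint here here)
  ∣p∪q∣≡∣p∣+∣q∣ {p = inside ∷ p}  {outside ∷ q} disjoint =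
    cong ℕ.suc (∣p∪q∣≡∣p∣+∣q∣ (drop-disjoint disjoint))
  ∣p∪q∣≡∣p∣+∣q∣ {p = outside ∷ p} {inside ∷ q}  disjoint =
    trans (cong ℕ.suc (∣p∪q∣≡∣p∣+∣q∣ (drop-disjoint disjoint))) (sym (+-suc ∣ p ∣ ∣ q ∣))
  ∣p∪q∣≡∣p∣+∣q∣ {p = outside ∷ p} {outside ∷ q} disjoint = ∣p∪q∣≡∣p∣+∣q∣ (drop-disjoint disjoint)

  indicator : Subset n → Fin n → ℕ
  indicator p x = if lookup p x then 1 else 0

  ∣p∣≡∑indicator : ∀ (p : Subset n) → ∣ p ∣ ≡ sum (indicator p)
  ∣p∣≡∑indicator []            = refl
  ∣p∣≡∑indicator (inside ∷ p)  = cong ℕ.suc (∣p∣≡∑indicator p)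
  ∣p∣≡∑indicator (outside ∷ p) = ∣p∣≡∑indicator p

  indicator-preimage : ∀ (f : Fin m → Fin n) p x → indicator (preimage f p) x ≡ indicator p (f x)
  indicator-preimage f p x = cong (λ b → if b then 1 else 0) (lookup∘tabulate (lookup p ∘ f) x)

  ∣preimage∣-permutation : ∀ (π : Permutation n n) p → ∣ preimage (π ⟨$⟩ʳ_) p ∣ ≡ ∣ p ∣
  ∣preimage∣-permutation π p = begin
    ∣ preimage (π ⟨$⟩ʳ_) p ∣                  ≡⟨ ∣p∣≡∑indicator (preimage (π ⟨$⟩ʳ_) p) ⟩
    sum (indicator (preimage (π ⟨$⟩ʳ_) p))   ≡⟨ sum-cong-≗ (indicator-preimage (π ⟨$⟩ʳ_) p) ⟩
    sum (indicator p ∘ (π ⟨$⟩ʳ_))            ≡⟨ sum-permute (indicator p) π ⟨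
    sum (indicator p)                        ≡⟨ ∣p∣≡∑indicator p ⟨
    ∣ p ∣                                    ∎

  ∑-select : ∀ (a : Fin n → ℕ) z → sum (λ y → a y * indicator ⁅ y ⁆ z) ≡ a z
  ∑-select {ℕ.suc n} a zero = begin
    a zero * 1 + sum (λ y → a (suc y) * indicator ⁅ suc y ⁆ zero)
      ≡⟨ cong₂ _+_ (*-identityʳ (a zero)) (sum-cong-≗ (λ y → *-zeroʳ (a (suc y)))) ⟩
    a zero + sum {n} (λ _ → 0)   ≡⟨ cong (a zero +_) (sum-replicate-zero n) ⟩
    a zero + 0                   ≡⟨ +-identityʳ (a zero) ⟩
    a zero                       ∎
  ∑-select {ℕ.suc n} a (suc z) = begin
    a zero * indicator ∅ z + rest  ≡⟨ cong (λ b → a zero * (if b then 1 else 0) + rest) (lookup-replicate z outside) ⟩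
    a zero * 0 + rest              ≡⟨ cong (_+ rest) (*-zeroʳ (a zero)) ⟩
    rest                           ≡⟨ ∑-select (a ∘ suc) z ⟩
    a (suc z)                      ∎
    where
    rest : ℕ
    rest = sum (λ y → a (suc y) * indicator ⁅ y ⁆ z)

  ∣preimage∣-constantFibres : ∀ (f : Fin m → Fin n) p {k} →
    (∀ {y} → y ∈ p → ∣ preimage f ⁅ y ⁆ ∣ ≡ k) → ∣ preimage f p ∣ ≡ ∣ p ∣ * k
  ∣preimage∣-constantFibres {m = m} {n = n} f p {k} fibre = begin
    ∣ preimage f p ∣                                     ≡⟨ ∣p∣≡∑indicator (preimage f p) ⟩
    sum (indicator (preimage f p))                       ≡⟨ sum-cong-≗ (indicator-preimage f p) ⟩
    sum (λ x → indicator p (f x))                        ≡⟨ sum-cong-≗ (λ x → ∑-select (indicator p) (f x)) ⟨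
    sum (λ x → sum (λ y → term y x))                     ≡⟨ ∑-comm (λ x y → term y x) ⟩
    sum (λ y → sum (term y))                             ≡⟨ sum-cong-≗ (λ y → *-distribˡ-sum (indicator p y) (fibreIndicator y)) ⟨
    sum (λ y → indicator p y * sum (fibreIndicator y))   ≡⟨ sum-cong-≗ (λ y → cong (indicator p y *_) (∑fibreIndicator y)) ⟩
    sum (λ y → indicator p y * ∣ preimage f ⁅ y ⁆ ∣)     ≡⟨ sum-cong-≗ constant ⟩
    sum (λ y → indicator p y * k)                        ≡⟨ *-distribʳ-sum k (indicator p) ⟨
    sum (indicator p) * k                                ≡⟨ cong (_* k) (∣p∣≡∑indicator p) ⟨
    ∣ p ∣ * k                                            ∎
    where
    fibreIndicator : Fin n → Fin m → ℕ
    fibreIndicator y x = indicator ⁅ y ⁆ (f x)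
    term : Fin n → Fin m → ℕ
    term y x = indicator p y * fibreIndicator y x
    ∑fibreIndicator : ∀ y → sum (fibreIndicator y) ≡ ∣ preimage f ⁅ y ⁆ ∣
    ∑fibreIndicator y = sym (trans (∣p∣≡∑indicator (preimage f ⁅ y ⁆)) (sum-cong-≗ (indicator-preimage f ⁅ y ⁆)))
    constant : ∀ y → indicator p y * ∣ preimage f ⁅ y ⁆ ∣ ≡ indicator p y * k
    constant y with lookup p y in y∈p
    ... | true  = cong (1 *_) (fibre (lookup⇒[]= y p y∈p))
    ... | false = refl

  Invariant : (Fin n → Fin n) → Subset n → Set
  Invariant σ p = ∀ {x} → x ∈ p → σ x ∈ p

  fixedPoints : (Fin n → Fin n) → Subset n
  fixedPoints σ = ⟦ (λ x → σ x ≟ᶠ x) ⟧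

  module _ {σ : Fin n → Fin n} (σ-involutive : ∀ x → σ (σ x) ≡ x) where

    private
      fixed? : Decidable (λ x → σ x ≡ x)
      fixed? x = σ x ≟ᶠ x
      ascending? : Decidable (λ x → x < σ x)
      ascending? x = x <ᶠ? σ x

    -- p splits into its fixed points, the x with x < σ x, and their images under σ.
    ∣invariant∣≡∣fixed∣+even : Invariant σ p → ∃ λ c → ∣ p ∣ ≡ ∣ p ∩ fixedPoints σ ∣ + 2 * c
    ∣invariant∣≡∣fixed∣+even {p = p} σp = ∣ up ∣ , (begin
      ∣ p ∣                             ≡⟨ cong ∣_∣ (⊆-antisym split unsplit) ⟩
      ∣ fix ∪ (up ∪ down) ∣             ≡⟨ ∣p∪q∣≡∣p∣+∣q∣ fix∩updown ⟩
      ∣ fix ∣ + ∣ up ∪ down ∣           ≡⟨ cong (∣ fix ∣ +_) (∣p∪q∣≡∣p∣+∣q∣ up∩down) ⟩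
      ∣ fix ∣ + (∣ up ∣ + ∣ down ∣)     ≡⟨ cong (λ d → ∣ fix ∣ + (∣ up ∣ + d)) ∣down∣≡∣up∣ ⟩
      ∣ fix ∣ + (∣ up ∣ + ∣ up ∣)       ≡⟨ cong (λ u → ∣ fix ∣ + (∣ up ∣ + u)) (+-identityʳ ∣ up ∣) ⟨
      ∣ fix ∣ + 2 * ∣ up ∣              ∎)
      where
      fix up down : Subset n
      fix  = p ∩ fixedPoints σ
      up   = p ∩ ⟦ ascending? ⟧
      down = preimage σ up
      ascending : ∀ {x} → x ∈ up → x < σ x
      ascending x∈up = ∈⟦⟧⁻ ascending? (proj₂ (x∈p∩q⁻ p _ x∈up))
      ∣down∣≡∣up∣ : ∣ down ∣ ≡ ∣ up ∣
      ∣down∣≡∣up∣ = ∣preimage∣-permutation (permutation σ σ σ-involutive σ-involutive) up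
      split : p ⊆ fix ∪ (up ∪ down)
      split {x} x∈p with <-cmp x (σ x)
      ... | tri< x<σx _ _ = x∈p∪q⁺ (inj₂ (x∈p∪q⁺ (inj₁ (x∈p∩q⁺ (x∈p , ∈⟦⟧⁺ ascending? x<σx)))))
      ... | tri≈ _ x≡σx _ = x∈p∪q⁺ (inj₁ (x∈p∩q⁺ (x∈p , ∈⟦⟧⁺ fixed? (sym x≡σx))))
      ... | tri> _ _ σx<x = x∈p∪q⁺ (inj₂ (x∈p∪q⁺ (inj₂ (∈-preimage⁺ (x∈p∩q⁺
                              (σp x∈p , ∈⟦⟧⁺ ascending? (subst (σ x <_) (sym (σ-involutive x)) σx<x)))))))
      unsplit : fix ∪ (up ∪ down) ⊆ p
      unsplit {x} x∈ with x∈p∪q⁻ fix _ x∈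
      ... | inj₁ x∈fix = proj₁ (x∈p∩q⁻ p _ x∈fix)
      ... | inj₂ x∈updown with x∈p∪q⁻ up down x∈updown
      ...   | inj₁ x∈up   = proj₁ (x∈p∩q⁻ p _ x∈up)
      ...   | inj₂ x∈down = subst (_∈ p) (σ-involutive x) (σp (proj₁ (x∈p∩q⁻ p _ (∈-preimage⁻ x∈down))))
      fix∩updown : ∀ {x} → x ∈ fix → x ∉ up ∪ down
      fix∩updown {x} x∈fix x∈updown with ∈⟦⟧⁻ fixed? (proj₂ (x∈p∩q⁻ p _ x∈fix)) | x∈p∪q⁻ up down x∈updown
      ... | σx≡x | inj₁ x∈up   = <-irrefl (sym σx≡x) (ascending x∈up)
      ... | σx≡x | inj₂ x∈down =
        <-irrefl (trans σx≡x (sym (trans (cong σ σx≡x) σx≡x))) (ascending (∈-preimage⁻ x∈down))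
      up∩down : ∀ {x} → x ∈ up → x ∉ down
      up∩down {x} x∈up x∈down =
        <-asym (ascending x∈up) (subst (σ x <_) (σ-involutive x) (ascending (∈-preimage⁻ x∈down)))

    module _ {p : Subset n} {x₀ : Fin n} (σp : Invariant σ p)
             (onlyFixed : ∀ {x} → x ∈ p → σ x ≡ x → x ≡ x₀) where

      ∣invariant∣-odd : x₀ ∈ p → σ x₀ ≡ x₀ → ∃ λ c → ∣ p ∣ ≡ ℕ.suc (2 * c)
      ∣invariant∣-odd x₀∈p σx₀≡x₀ with ∣invariant∣≡∣fixed∣+even σp
      ... | c , ∣p∣≡ = c , trans ∣p∣≡ (cong (_+ 2 * c) (trans (cong ∣_∣ fix≡⁅x₀⁆) (∣⁅x⁆∣≡1 x₀)))
        where
        fix≡⁅x₀⁆ : p ∩ fixedPoints σ ≡ ⁅ x₀ ⁆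
        fix≡⁅x₀⁆ = ⊆-antisym
          (λ x∈ → let x∈p , x∈fixed = x∈p∩q⁻ p _ x∈ in
                  subst (_∈ ⁅ x₀ ⁆) (sym (onlyFixed x∈p (∈⟦⟧⁻ fixed? x∈fixed))) (x∈⁅x⁆ x₀))
          (λ x∈⁅x₀⁆ → subst (_∈ p ∩ fixedPoints σ) (sym (x∈⁅y⁆⇒x≡y x₀ x∈⁅x₀⁆))
                                (x∈p∩q⁺ (x₀∈p , ∈⟦⟧⁺ fixed? σx₀≡x₀)))

      ∣invariant∣-even : x₀ ∉ p → ∃ λ c → ∣ p ∣ ≡ 2 * c
      ∣invariant∣-even x₀∉p with ∣invariant∣≡∣fixed∣+even σp
      ... | c , ∣p∣≡ = c , trans ∣p∣≡ (cong (_+ 2 * c) (trans (cong ∣_∣ fix≡∅) (∣⊥∣≡0 n)))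
        where
        fix≡∅ : p ∩ fixedPoints σ ≡ ∅
        fix≡∅ = ⊆-antisym
          (λ x∈ → let x∈p , x∈fixed = x∈p∩q⁻ p _ x∈ in
                  ⊥-elim (x₀∉p (subst (_∈ p) (onlyFixed x∈p (∈⟦⟧⁻ fixed? x∈fixed)) x∈p)))
          (λ x∈∅ → ⊥-elim (∉⊥ x∈∅))

  Maximal : (Subset n → Set ℓ) → Subset n → Set ℓ
  Maximal P p = P p × (∀ q → P q → p ⊆ q → q ⊆ p)

  -- Only under ¬ ¬: whether a larger q with P q exists is not decidable for arbitrary P.
  maximal-extension : ∀ (P : Subset n → Set ℓ) → P p → ¬ ¬ (∃ λ m → p ⊆ m × Maximal P m)
  maximal-extension {n = n} {p = p} P Pp = extend p Pp (λ x∈p → x∈p) (<-wellFounded (n ∸ ∣ p ∣))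
    where
    extend : ∀ q → P q → p ⊆ q → Acc ℕ._<_ (n ∸ ∣ q ∣) → ¬ ¬ (∃ λ m → p ⊆ m × Maximal P m)
    extend q Pq p⊆q (acc rec) noMaximal = noMaximal (q , p⊆q , Pq , maximal)
      where
      maximal : ∀ r → P r → q ⊆ r → r ⊆ q
      maximal r Pr q⊆r {x} x∈r with x ∈? q
      ... | yes x∈q = x∈q
      ... | no  x∉q = ⊥-elim (extend r Pr (q⊆r ∘ p⊆q) (rec (∸-monoʳ-< ∣q∣<∣r∣ (∣p∣≤n r))) noMaximal)
        where
        ∣q∣<∣r∣ : ∣ q ∣ ℕ.< ∣ r ∣
        ∣q∣<∣r∣ = p⊂q⇒∣p∣<∣q∣ (q⊆r , x , x∈r , x∉q)

module Graphs where

  open import Data.Fin.Base using (Fin)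
  open import Data.Fin.Subset using (Subset; _∈_; _⊆_; _∪_; ⁅_⁆)
  open import Data.Fin.Subset.Properties using (x∈p∪q⁻; x∈p∪q⁺; x∈⁅x⁆; x∈⁅y⁆⇒x≡y)
  open import Data.Nat.Base using (ℕ)
  open import Data.Sum using (inj₁; inj₂)
  open import Function.Base using (_∘_)
  open import Relation.Binary.PropositionalEquality using (_≡_; sym; subst; subst₂)
  open import Relation.Nullary using (¬_)
  open FiniteSubsets using (preimage; ∈-preimage⁺; ∈-preimage⁻; Invariant; Maximal)

  private
    variable
      n : ℕ

  wellCovered-resp-⇔ : ∀ {A B : Fin n → Fin n → Set} → (∀ x y → A x y ⇔ B x y) → WellCovered A ⇔ WellCovered B
  wellCovered-resp-⇔ {A = A} {B} A⇔B = mk⇔ (transfer A⇒B B⇒A) (transfer B⇒A A⇒B)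
    where
    A⇒B : ∀ {x y} → A x y → B x y
    A⇒B {x} {y} = Equivalence.to (A⇔B x y)
    B⇒A : ∀ {x y} → B x y → A x y
    B⇒A {x} {y} = Equivalence.from (A⇔B x y)
    transfer : ∀ {C D : Fin n → Fin n → Set} → (∀ {x y} → C x y → D x y) → (∀ {x y} → D x y → C x y) →
               WellCovered C → WellCovered D
    transfer {C = C} {D} C⇒D D⇒C wcC S T S-max T-max = wcC S T (maximal S-max) (maximal T-max)
      where
      maximal : ∀ {S} → IsMaximalIndependent D S → IsMaximalIndependent C S
      maximal (indep , max) = (λ x y x∈ y∈ → indep x y x∈ y∈ ∘ C⇒D)
                            , λ T indepT S⊆T → max T (λ x y x∈ y∈ → indepT x y x∈ y∈ ∘ D⇒C) S⊆T

  module Involution {Adj : Fin n → Fin n → Set} {σ : Fin n → Fin n}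
           (σ-involutive : ∀ x → σ (σ x) ≡ x)
           (σ-adjacent : ∀ {x y} → Adj x y → Adj (σ x) (σ y))
           (σ-nonadjacent : ∀ x → ¬ Adj x (σ x)) where

    saturation : Subset n → Subset n
    saturation S = S ∪ preimage σ S

    saturation-invariant : ∀ S → Invariant σ (saturation S)
    saturation-invariant S x∈ with x∈p∪q⁻ S _ x∈
    ... | inj₁ x∈S  = x∈p∪q⁺ (inj₂ (∈-preimage⁺ (subst (_∈ S) (sym (σ-involutive _)) x∈S)))
    ... | inj₂ σx∈S = x∈p∪q⁺ (inj₁ (∈-preimage⁻ σx∈S))

    saturation-independent : ∀ {S} → IsIndependent Adj S → (∀ {x y} → x ∈ S → y ∈ S → ¬ Adj x (σ y)) →
                             IsIndependent Adj (saturation S)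
    saturation-independent {S} indep cross x y x∈ y∈ adj with x∈p∪q⁻ S _ x∈ | x∈p∪q⁻ S _ y∈
    ... | inj₁ x∈S  | inj₁ y∈S  = indep x y x∈S y∈S adj
    ... | inj₁ x∈S  | inj₂ σy∈S = cross x∈S (∈-preimage⁻ σy∈S) (subst (Adj x) (sym (σ-involutive y)) adj)
    ... | inj₂ σx∈S | inj₁ y∈S  = cross (∈-preimage⁻ σx∈S) y∈S (σ-adjacent adj)
    ... | inj₂ σx∈S | inj₂ σy∈S = indep (σ x) (σ y) (∈-preimage⁻ σx∈S) (∈-preimage⁻ σy∈S) (σ-adjacent adj)

    saturation-⁅⁆-independent : ∀ {x} → ¬ Adj x x → IsIndependent Adj (saturation ⁅ x ⁆)
    saturation-⁅⁆-independent {x} ¬xx = saturation-independent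
      (λ y z y∈ z∈ → ¬xx ∘ subst₂ Adj (x∈⁅y⁆⇒x≡y x y∈) (x∈⁅y⁆⇒x≡y x z∈))
      (λ y∈ z∈ → σ-nonadjacent x ∘ subst₂ (λ a b → Adj a (σ b)) (x∈⁅y⁆⇒x≡y x y∈) (x∈⁅y⁆⇒x≡y x z∈))

    -- For x ∈ T ⊇ M, saturating M ∪ {x} stays independent because σ M = M ⊆ T.
    invariant-maximal⇒maximal : ∀ {M} → Maximal (λ S → IsIndependent Adj S × Invariant σ S) M →
                                IsMaximalIndependent Adj M
    invariant-maximal⇒maximal {M} ((indepM , σM) , maxM) = indepM , maximal
      where
      maximal : ∀ T → IsIndependent Adj T → M ⊆ T → T ⊆ M
      maximal T indepT M⊆T {x} x∈T = maxM (saturation S) (indepJ , saturation-invariant S) M⊆J x∈J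
        where
        S : Subset n
        S = M ∪ ⁅ x ⁆
        S⊆T : S ⊆ T
        S⊆T y∈S with x∈p∪q⁻ M _ y∈S
        ... | inj₁ y∈M   = M⊆T y∈M
        ... | inj₂ y∈⁅x⁆ = subst (_∈ T) (sym (x∈⁅y⁆⇒x≡y x y∈⁅x⁆)) x∈T
        cross : ∀ {y z} → y ∈ S → z ∈ S → ¬ Adj y (σ z)
        cross {y} {z} y∈S z∈S with x∈p∪q⁻ M _ z∈S
        ... | inj₁ z∈M   = indepT y (σ z) (S⊆T y∈S) (M⊆T (σM z∈M))
        ... | inj₂ z∈⁅x⁆ with x∈p∪q⁻ M _ y∈S
        ...   | inj₁ y∈M   = λ adj → indepT (σ y) z (M⊆T (σM y∈M)) (S⊆T z∈S)
                               (subst (Adj (σ y)) (σ-involutive z) (σ-adjacent adj))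
        ...   | inj₂ y∈⁅x⁆ =
          σ-nonadjacent x ∘ subst₂ (λ a b → Adj a (σ b)) (x∈⁅y⁆⇒x≡y x y∈⁅x⁆) (x∈⁅y⁆⇒x≡y x z∈⁅x⁆)
        indepJ : IsIndependent Adj (saturation S)
        indepJ = saturation-independent (λ y z y∈S z∈S → indepT y z (S⊆T y∈S) (S⊆T z∈S)) cross
        M⊆J : M ⊆ saturation S
        M⊆J y∈M = x∈p∪q⁺ (inj₁ (x∈p∪q⁺ (inj₁ y∈M)))
        x∈J : x ∈ saturation S
        x∈J = x∈p∪q⁺ (inj₁ (x∈p∪q⁺ (inj₂ (x∈⁅x⁆ x))))

module OddDivisors where

  open import Data.Nat.Base using (zero; suc; _+_; _*_; _^_)
  open import Data.Nat.Properties using (*-identityʳ; *-assoc)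
  open import Data.Nat.Divisibility using (_∣_; ∣m+n∣m⇒∣n; ∣n⇒∣m*n; m∣m*n)
  open import Data.Nat.Tactic.RingSolver using (solve-∀)
  open import Relation.Binary.PropositionalEquality using (_≡_; sym; subst)

  odd∣2n⇒odd∣n : ∀ c n → suc (2 * c) ∣ n * 2 → suc (2 * c) ∣ n
  odd∣2n⇒odd∣n c n odd∣2n = ∣m+n∣m⇒∣n (subst (suc (2 * c) ∣_) (expand c n) (m∣m*n n)) (∣n⇒∣m*n c odd∣2n)
    where
    expand : ∀ c n → suc (2 * c) * n ≡ c * (n * 2) + n
    expand = solve-∀

  odd∣n*2^m⇒odd∣n : ∀ c n m → suc (2 * c) ∣ n * 2 ^ m → suc (2 * c) ∣ n
  odd∣n*2^m⇒odd∣n c n zero    odd∣ = subst (suc (2 * c) ∣_) (*-identityʳ n) odd∣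
  odd∣n*2^m⇒odd∣n c n (suc m) odd∣ =
    odd∣2n⇒odd∣n c n (odd∣n*2^m⇒odd∣n c (n * 2) m (subst (suc (2 * c) ∣_) (sym (*-assoc n 2 (2 ^ m))) odd∣))

module RingTheory (R : FiniteRing) where

  open import Level using (0ℓ)
  open import Algebra.Bundles using (Ring)
  open import Data.Empty using (⊥-elim)
  open import Data.Fin.Base using (Fin; toℕ)
  open import Data.Fin.Permutation using (permutation)
  open import Data.Fin.Properties using (any?; pigeonhole) renaming (_≟_ to _≟ᶠ_)
  open import Data.Fin.Subset using (Subset; _∈_; _∉_; _⊆_; _∪_; ⁅_⁆; ∣_∣)
  open import Data.Fin.Subset.Properties
    using (_∈?_; x∈⁅x⁆; x∈⁅y⁆⇒x≡y; ⊆-antisym; x∈p∪q⁺; x∈p∪q⁻; p⊂q⇒∣p∣<∣q∣; p⊆q⇒∣p∣≤∣q∣; ∣p∣≤n; ∣⁅x⁆∣≡1)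
  open import Data.Nat.Base as ℕ using (ℕ; zero; suc; _≤_; >-nonZero)
  import Data.Nat.Properties as ℕ
  open import Data.Nat.Divisibility using (_∣_; divides; ∣⇒≤)
  open import Data.Nat.Induction using (<-wellFounded)
  open import Data.Product using (∃; ∃₂; proj₁; proj₂)
  open import Data.Sum using (_⊎_; inj₁; inj₂)
  open import Function.Base using (_∘_)
  open import Induction.WellFounded using (Acc; acc)
  open import Relation.Binary.PropositionalEquality
  open import Relation.Nullary using (¬_; Dec; yes; no; ¬?; _×-dec_)
  open import Relation.Nullary.Decidable using (decidable-stable)
  open import Relation.Unary using (Decidable)
  open import Algebra.Properties.CommutativeSemigroup ℕ.+-commutativeSemigroup using (xy∙z≈y∙xz)
  open FiniteSubsets
  open Graphs using (module Involution)
  open OddDivisors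

  open FiniteRing R using (size; isRing; 1≢0)

  ring : Ring 0ℓ 0ℓ
  ring = record { isRing = isRing }

  open Ring ring
    using (_+_; _*_; -_; _-_; 0#; 1#; +-assoc; +-comm; +-identityˡ; +-identityʳ; -‿inverseˡ; -‿inverseʳ;
           *-assoc; *-identityˡ; *-identityʳ; distribˡ; distribʳ; zeroˡ; zeroʳ; semiring;
           +-commutativeMonoid; +-commutativeSemigroup)
  open import Algebra.Properties.Ring ring
    using (-‿involutive; -‿injective; -‿distribˡ-*; -‿distribʳ-*; -0#≈0#; -‿+-comm; -1*x≈-x;
           x∙y⁻¹≈ε⇒x≈y; +-cancelʳ; x[y-z]≈xy-xz; [y-z]x≈yx-zx)
  open import Algebra.Properties.Semiring.Exp semiring using (_^_; ^-homo-*)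
  open import Algebra.Properties.CommutativeSemigroup +-commutativeSemigroup using (interchange; xy∙z≈xz∙y)
  import Algebra.Solver.CommutativeMonoid +-commutativeMonoid as CM
  open CM using (_⊕_; _⊜_)
  open ≡-Reasoning

  x-0≡x : ∀ x → x - 0# ≡ x
  x-0≡x x = trans (cong (x +_) -0#≈0#) (+-identityʳ x)

  x+y-y≡x : ∀ x y → x + y - y ≡ x
  x+y-y≡x x y = trans (+-assoc x y (- y)) (trans (cong (x +_) (-‿inverseʳ y)) (+-identityʳ x))

  x-y+y≡x : ∀ x y → x - y + y ≡ x
  x-y+y≡x x y = trans (+-assoc x (- y) y) (trans (cong (x +_) (-‿inverseˡ y)) (+-identityʳ x))

  [x-y]+[y-z]≡x-z : ∀ x y z → (x - y) + (y - z) ≡ x - z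
  [x-y]+[y-z]≡x-z x y z = begin
    (x - y) + (y - z)    ≡⟨ +-assoc x (- y) (y - z) ⟩
    x + (- y + (y - z))  ≡⟨ cong (x +_) (+-assoc (- y) y (- z)) ⟨
    x + (- y + y - z)    ≡⟨ cong (λ w → x + (w - z)) (-‿inverseˡ y) ⟩
    x + (0# - z)         ≡⟨ cong (x +_) (+-identityˡ (- z)) ⟩
    x - z                ∎

  x-[x-y]≡y : ∀ x y → x - (x - y) ≡ y
  x-[x-y]≡y x y = begin
    x - (x - y)      ≡⟨ cong (x +_) (-‿+-comm x (- y)) ⟨
    x + (- x - - y)  ≡⟨ cong (λ z → x + (- x + z)) (-‿involutive y) ⟩
    x + (- x + y)    ≡⟨ +-assoc x (- x) y ⟨
    (x - x) + y      ≡⟨ cong (_+ y) (-‿inverseʳ x) ⟩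
    0# + y           ≡⟨ +-identityˡ y ⟩
    y                ∎

  [x-y]+[y+y]≡x+y : ∀ x y → (x - y) + (y + y) ≡ x + y
  [x-y]+[y+y]≡x+y x y = begin
    (x - y) + (y + y)      ≡⟨ +-assoc x (- y) (y + y) ⟩
    x + (- y + (y + y))    ≡⟨ cong (x +_) (+-assoc (- y) y y) ⟨
    x + ((- y + y) + y)    ≡⟨ cong (λ z → x + (z + y)) (-‿inverseˡ y) ⟩
    x + (0# + y)           ≡⟨ cong (x +_) (+-identityˡ y) ⟩
    x + y                  ∎

  [x+y]-[y+y]≡x-y : ∀ x y → (x + y) - (y + y) ≡ x - y
  [x+y]-[y+y]≡x-y x y = begin
    (x + y) - (y + y)      ≡⟨ cong ((x + y) +_) (-‿+-comm y y) ⟨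
    (x + y) + (- y - y)    ≡⟨ +-assoc x y (- y - y) ⟩
    x + (y + (- y - y))    ≡⟨ cong (x +_) (+-assoc y (- y) (- y)) ⟨
    x + ((y - y) - y)      ≡⟨ cong (λ z → x + (z - y)) (-‿inverseʳ y) ⟩
    x + (0# - y)           ≡⟨ cong (x +_) (+-identityˡ (- y)) ⟩
    x - y                  ∎

  two : Elem R
  two = 1# + 1#

  two*x≡x+x : ∀ x → two * x ≡ x + x
  two*x≡x+x x = trans (distribʳ x 1# 1#) (cong₂ _+_ (*-identityˡ x) (*-identityˡ x))

  x*two≡x+x : ∀ x → x * two ≡ x + x
  x*two≡x+x x = trans (distribˡ x 1# 1#) (cong₂ _+_ (*-identityʳ x) (*-identityʳ x))

  Central : Elem R → Set
  Central c = ∀ x → c * x ≡ x * c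

  two-central : Central two
  two-central x = trans (two*x≡x+x x) (sym (x*two≡x+x x))

  *-central : ∀ {c d} → Central c → Central d → Central (c * d)
  *-central {c} {d} c-central d-central x = begin
    c * d * x    ≡⟨ *-assoc c d x ⟩
    c * (d * x)  ≡⟨ cong (c *_) (d-central x) ⟩
    c * (x * d)  ≡⟨ *-assoc c x d ⟨
    c * x * d    ≡⟨ cong (_* d) (c-central x) ⟩
    x * c * d    ≡⟨ *-assoc x c d ⟩
    x * (c * d)  ∎

  ^-central : ∀ {c} → Central c → ∀ k → Central (c ^ k)
  ^-central c-central zero    x = trans (*-identityˡ x) (sym (*-identityʳ x))
  ^-central c-central (suc k) = *-central c-central (^-central c-central k)

  x*x^k≡x^k*x : ∀ x k → x * x ^ k ≡ x ^ k * x
  x*x^k≡x^k*x x zero    = trans (*-identityʳ x) (sym (*-identityˡ x))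
  x*x^k≡x^k*x x (suc k) = trans (cong (x *_) (x*x^k≡x^k*x x k)) (sym (*-assoc x (x ^ k) x))

  *-^-central : ∀ {c} → Central c → ∀ r k → (r * c) ^ k ≡ r ^ k * c ^ k
  *-^-central c-central r zero    = sym (*-identityˡ 1#)
  *-^-central {c} c-central r (suc k) = begin
    r * c * (r * c) ^ k       ≡⟨ cong (r * c *_) (*-^-central c-central r k) ⟩
    r * c * (r ^ k * c ^ k)   ≡⟨ *-assoc r c _ ⟩
    r * (c * (r ^ k * c ^ k)) ≡⟨ cong (r *_) (*-assoc c (r ^ k) (c ^ k)) ⟨
    r * (c * r ^ k * c ^ k)   ≡⟨ cong (λ y → r * (y * c ^ k)) (c-central (r ^ k)) ⟩
    r * (r ^ k * c * c ^ k)   ≡⟨ cong (r *_) (*-assoc (r ^ k) c (c ^ k)) ⟩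
    r * (r ^ k * (c * c ^ k)) ≡⟨ *-assoc r (r ^ k) _ ⟨
    r * r ^ k * (c * c ^ k)   ∎

  idempotent-^ : ∀ {x} → x * x ≡ x → ∀ k → x ^ suc k ≡ x
  idempotent-^ {x} xx≡x zero    = *-identityʳ x
  idempotent-^ {x} xx≡x (suc k) = trans (cong (x *_) (idempotent-^ xx≡x k)) xx≡x

  powers-collide : ∀ x → ∃₂ λ a p → x ^ (a ℕ.+ suc p) ≡ x ^ a
  powers-collide x with pigeonhole (ℕ.n<1+n size) (λ (i : Fin (suc size)) → x ^ toℕ i)
  ... | i , j , i<j , xⁱ≡xʲ with ℕ.m≤n⇒∃[o]m+o≡n i<j
  ...   | p , i+1+p≡j = toℕ i , p , (begin
    x ^ (toℕ i ℕ.+ suc p) ≡⟨ cong (x ^_) (trans (ℕ.+-suc (toℕ i) p) i+1+p≡j) ⟩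
    x ^ toℕ j             ≡⟨ xⁱ≡xʲ ⟨
    x ^ toℕ i             ∎)

  ^-periodic : ∀ {x a q} → x ^ (a ℕ.+ q) ≡ x ^ a → ∀ {n} → a ≤ n → ∀ m → x ^ (n ℕ.+ m ℕ.* q) ≡ x ^ n
  ^-periodic {x} {a} {q} period {n} a≤n zero    = cong (x ^_) (ℕ.+-identityʳ n)
  ^-periodic {x} {a} {q} period {n} a≤n (suc m) = begin
    x ^ (n ℕ.+ (q ℕ.+ m ℕ.* q))  ≡⟨ cong (x ^_) (ℕ.+-assoc n q (m ℕ.* q)) ⟨
    x ^ (n ℕ.+ q ℕ.+ m ℕ.* q)    ≡⟨ ^-periodic period (ℕ.≤-trans a≤n (ℕ.m≤m+n n q)) m ⟩
    x ^ (n ℕ.+ q)                ≡⟨ shift a≤n ⟩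
    x ^ n                        ∎
    where
    shift : ∀ {n} → a ≤ n → x ^ (n ℕ.+ q) ≡ x ^ n
    shift a≤n with ℕ.m≤n⇒∃[o]m+o≡n a≤n
    ... | d , refl = begin
      x ^ (a ℕ.+ d ℕ.+ q)      ≡⟨ cong (x ^_) (xy∙z≈y∙xz a d q) ⟩
      x ^ (d ℕ.+ (a ℕ.+ q))    ≡⟨ ^-homo-* x d (a ℕ.+ q) ⟩
      x ^ d * x ^ (a ℕ.+ q)    ≡⟨ cong (x ^ d *_) period ⟩
      x ^ d * x ^ a            ≡⟨ ^-homo-* x d a ⟨
      x ^ (d ℕ.+ a)            ≡⟨ cong (x ^_) (ℕ.+-comm d a) ⟩
      x ^ (a ℕ.+ d)            ∎

  idempotent-power : ∀ x → ∃ λ k → x ^ suc k * x ^ suc k ≡ x ^ suc k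
  idempotent-power x with powers-collide x
  ... | a , p , period = p ℕ.+ a ℕ.* suc p , (begin
    x ^ n * x ^ n    ≡⟨ ^-homo-* x n n ⟨
    x ^ (n ℕ.+ n)    ≡⟨ ^-periodic period a≤n (suc a) ⟩
    x ^ n            ∎)
    where
    n : ℕ
    n = suc a ℕ.* suc p
    a≤n : a ≤ n
    a≤n = ℕ.≤-trans (ℕ.n≤1+n a) (ℕ.m≤m*n (suc a) (suc p))

  leftInverse-^ : ∀ {r w} → r * w ≡ 1# → ∀ k → r ^ k * w ^ k ≡ 1#
  leftInverse-^ rw≡1 zero = *-identityˡ 1#
  leftInverse-^ {r} {w} rw≡1 (suc k) = begin
    r * r ^ k * (w * w ^ k)    ≡⟨ cong (r * r ^ k *_) (x*x^k≡x^k*x w k) ⟩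
    r * r ^ k * (w ^ k * w)    ≡⟨ *-assoc r (r ^ k) _ ⟩
    r * (r ^ k * (w ^ k * w))  ≡⟨ cong (r *_) (*-assoc (r ^ k) (w ^ k) w) ⟨
    r * (r ^ k * w ^ k * w)    ≡⟨ cong (λ y → r * (y * w)) (leftInverse-^ rw≡1 k) ⟩
    r * (1# * w)               ≡⟨ cong (r *_) (*-identityˡ w) ⟩
    r * w                      ≡⟨ rw≡1 ⟩
    1#                         ∎

  -- A repetition r ^ a = r ^ (a + p + 1) gives r ^ (p + 1) = 1, so w = r ^ p.
  leftInverse⇒isUnit : ∀ {r w} → r * w ≡ 1# → IsUnit R w
  leftInverse⇒isUnit {r} {w} rw≡1 with powers-collide r
  ... | a , p , period = r , trans (cong (_* r) w≡rᵖ) (trans (sym (x*x^k≡x^k*x r p)) rᵖ⁺¹≡1) , rw≡1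
    where
    rᵖ⁺¹≡1 : r ^ suc p ≡ 1#
    rᵖ⁺¹≡1 = begin
      r ^ suc p                          ≡⟨ *-identityʳ (r ^ suc p) ⟨
      r ^ suc p * 1#                     ≡⟨ cong (r ^ suc p *_) (leftInverse-^ rw≡1 a) ⟨
      r ^ suc p * (r ^ a * w ^ a)        ≡⟨ *-assoc (r ^ suc p) (r ^ a) (w ^ a) ⟨
      r ^ suc p * r ^ a * w ^ a          ≡⟨ cong (_* w ^ a) (^-homo-* r (suc p) a) ⟨
      r ^ (suc p ℕ.+ a) * w ^ a          ≡⟨ cong (λ k → r ^ k * w ^ a) (ℕ.+-comm (suc p) a) ⟩
      r ^ (a ℕ.+ suc p) * w ^ a          ≡⟨ cong (_* w ^ a) period ⟩
      r ^ a * w ^ a                      ≡⟨ leftInverse-^ rw≡1 a ⟩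
      1#                                 ∎
    w≡rᵖ : w ≡ r ^ p
    w≡rᵖ = begin
      w                ≡⟨ *-identityˡ w ⟨
      1# * w           ≡⟨ cong (_* w) rᵖ⁺¹≡1 ⟨
      r * r ^ p * w    ≡⟨ cong (_* w) (x*x^k≡x^k*x r p) ⟩
      r ^ p * r * w    ≡⟨ *-assoc (r ^ p) r w ⟩
      r ^ p * (r * w)  ≡⟨ cong (r ^ p *_) rw≡1 ⟩
      r ^ p * 1#       ≡⟨ *-identityʳ (r ^ p) ⟩
      r ^ p            ∎

  isUnit? : ∀ x → Dec (IsUnit R x)
  isUnit? x = any? (λ y → (x * y ≟ᶠ 1#) ×-dec (y * x ≟ᶠ 1#))

  1-isUnit : IsUnit R 1#
  1-isUnit = 1# , *-identityˡ 1# , *-identityˡ 1#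

  0-notUnit : ¬ IsUnit R 0#
  0-notUnit (y , 0y≡1 , _) = 1≢0 (trans (sym 0y≡1) (zeroˡ y))

  *-isUnit : ∀ {a b} → IsUnit R a → IsUnit R b → IsUnit R (a * b)
  *-isUnit {a} {b} (a' , aa'≡1 , a'a≡1) (b' , bb'≡1 , b'b≡1) = b' * a' , cancel aa'≡1 bb'≡1 , cancel b'b≡1 a'a≡1
    where
    cancel : ∀ {x x' y y'} → x * x' ≡ 1# → y * y' ≡ 1# → x * y * (y' * x') ≡ 1#
    cancel {x} {x'} {y} {y'} xx'≡1 yy'≡1 = begin
      x * y * (y' * x')    ≡⟨ *-assoc x y _ ⟩
      x * (y * (y' * x'))  ≡⟨ cong (x *_) (*-assoc y y' x') ⟨
      x * (y * y' * x')    ≡⟨ cong (λ z → x * (z * x')) yy'≡1 ⟩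
      x * (1# * x')        ≡⟨ cong (x *_) (*-identityˡ x') ⟩
      x * x'               ≡⟨ xx'≡1 ⟩
      1#                   ∎

  -x*-y≡x*y : ∀ x y → - x * - y ≡ x * y
  -x*-y≡x*y x y = begin
    - x * - y      ≡⟨ -‿distribˡ-* x (- y) ⟨
    - (x * - y)    ≡⟨ cong -_ (-‿distribʳ-* x y) ⟨
    - - (x * y)    ≡⟨ -‿involutive (x * y) ⟩
    x * y          ∎

  -‿isUnit : ∀ {a} → IsUnit R a → IsUnit R (- a)
  -‿isUnit {a} (a' , aa'≡1 , a'a≡1) = - a' , trans (-x*-y≡x*y a a') aa'≡1 , trans (-x*-y≡x*y a' a) a'a≡1

  idempotent-isUnit⇒≡1 : ∀ {x} → x * x ≡ x → IsUnit R x → x ≡ 1#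
  idempotent-isUnit⇒≡1 {x} xx≡x (v , xv≡1 , _) = begin
    x             ≡⟨ *-identityʳ x ⟨
    x * 1#        ≡⟨ cong (x *_) xv≡1 ⟨
    x * (x * v)   ≡⟨ *-assoc x x v ⟨
    x * x * v     ≡⟨ cong (_* v) xx≡x ⟩
    x * v         ≡⟨ xv≡1 ⟩
    1#            ∎

  -- The Jacobson radical

  private
    principal? : ∀ w → Decidable (λ x → ∃ λ r → r * w ≡ x)
    principal? w x = any? (λ r → r * w ≟ᶠ x)

  principal : Elem R → Subset size
  principal w = ⟦ principal? w ⟧

  principal-isLeftIdeal : ∀ w → IsLeftIdeal R (principal w)
  principal-isLeftIdeal w = ∈⟦⟧⁺ (principal? w) (0# , zeroˡ w) , closed-+ , closed-*
    where
    closed-+ : ∀ x y → x ∈ principal w → y ∈ principal w → x + y ∈ principal w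
    closed-+ x y x∈ y∈ with ∈⟦⟧⁻ (principal? w) x∈ | ∈⟦⟧⁻ (principal? w) y∈
    ... | r , rw≡x | s , sw≡y = ∈⟦⟧⁺ (principal? w) (r + s , trans (distribʳ w r s) (cong₂ _+_ rw≡x sw≡y))
    closed-* : ∀ r x → x ∈ principal w → r * x ∈ principal w
    closed-* r x x∈ with ∈⟦⟧⁻ (principal? w) x∈
    ... | s , sw≡x = ∈⟦⟧⁺ (principal? w) (r * s , trans (*-assoc r s w) (cong (r *_) sw≡x))

  w∈principal : ∀ w → w ∈ principal w
  w∈principal w = ∈⟦⟧⁺ (principal? w) (1# , *-identityˡ w)

  1∈principal⇒isUnit : ∀ {w} → 1# ∈ principal w → IsUnit R w
  1∈principal⇒isUnit {w} 1∈ = leftInverse⇒isUnit (proj₂ (∈⟦⟧⁻ (principal? w) 1∈))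

  maximalLeftIdeal-extension : ∀ {I} → IsLeftIdeal R I → 1# ∉ I → ¬ ¬ (∃ λ M → I ⊆ M × IsMaximalLeftIdeal R M)
  maximalLeftIdeal-extension I-ideal 1∉I noMaximal =
    maximal-extension (λ J → IsLeftIdeal R J × 1# ∉ J) (I-ideal , 1∉I) λ (M , I⊆M , (M-ideal , 1∉M) , maxM) →
      noMaximal (M , I⊆M , M-ideal , 1∉M , λ J J-ideal M⊆J 1∉J → maxM J (J-ideal , 1∉J) M⊆J)

  1∉J : ¬ InJacobson R 1#
  1∉J 1∈J = maximalLeftIdeal-extension (principal-isLeftIdeal 0#) (0-notUnit ∘ 1∈principal⇒isUnit)
    λ (M , _ , M-maximal) → proj₁ (proj₂ M-maximal) (1∈J M M-maximal)

  J-*ˡ : ∀ {j} → InJacobson R j → ∀ r → InJacobson R (r * j)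
  J-*ˡ j∈J r M M-maximal = proj₂ (proj₂ (proj₁ M-maximal)) r _ (j∈J M M-maximal)

  J-‿ : ∀ {j} → InJacobson R j → InJacobson R (- j)
  J-‿ {j} j∈J = subst (InJacobson R) (-1*x≈-x j) (J-*ˡ j∈J (- 1#))

  -- A maximal left ideal containing u + j would contain j, hence u, hence 1.
  isUnit+J : ∀ {u j} → IsUnit R u → InJacobson R j → IsUnit R (u + j)
  isUnit+J {u} {j} (u' , _ , u'u≡1) j∈J = decidable-stable (isUnit? (u + j)) λ u+j-nonunit →
    maximalLeftIdeal-extension (principal-isLeftIdeal (u + j)) (u+j-nonunit ∘ 1∈principal⇒isUnit)
      λ (M , ⟨u+j⟩⊆M , M-maximal@((_ , closed-+ , closed-*) , 1∉M , _)) →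
        1∉M (subst (_∈ M) u'u≡1 (closed-* u' u (subst (_∈ M) (x+y-y≡x u j)
          (closed-+ _ _ (⟨u+j⟩⊆M (w∈principal (u + j))) (J-‿ j∈J M M-maximal)))))

  two∈J⇒isUnit-+⇔- : InJacobson R two → ∀ x y → IsUnit R (x + y) ⇔ IsUnit R (x - y)
  two∈J⇒isUnit-+⇔- two∈J x y =
    mk⇔ (λ u → subst (IsUnit R) ([x+y]-[y+y]≡x-y x y) (isUnit+J u (J-‿ y+y∈J)))
        (λ u → subst (IsUnit R) ([x-y]+[y+y]≡x+y x y) (isUnit+J u y+y∈J))
    where
    y+y∈J : InJacobson R (y + y)
    y+y∈J = subst (InJacobson R) (x*two≡x+x y) (J-*ˡ two∈J y)

  geometric-series : ∀ x k → ∃ λ g → g * (1# - x) ≡ 1# - x ^ k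
  geometric-series x zero    = 0# , trans (zeroˡ (1# - x)) (sym (-‿inverseʳ 1#))
  geometric-series x (suc k) with geometric-series x k
  ... | g , g[1-x]≡1-xᵏ = 1# + x * g , (begin
    (1# + x * g) * (1# - x)          ≡⟨ distribʳ (1# - x) 1# (x * g) ⟩
    1# * (1# - x) + x * g * (1# - x) ≡⟨ cong₂ _+_ (*-identityˡ (1# - x)) (*-assoc x g (1# - x)) ⟩
    (1# - x) + x * (g * (1# - x))    ≡⟨ cong (λ y → (1# - x) + x * y) g[1-x]≡1-xᵏ ⟩
    (1# - x) + x * (1# - x ^ k)      ≡⟨ cong ((1# - x) +_) (x[y-z]≈xy-xz x 1# (x ^ k)) ⟩
    (1# - x) + (x * 1# - x ^ suc k)  ≡⟨ cong (λ y → (1# - x) + (y - x ^ suc k)) (*-identityʳ x) ⟩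
    (1# - x) + (x - x ^ suc k)       ≡⟨ [x-y]+[y-z]≡x-z 1# x (x ^ suc k) ⟩
    1# - x ^ suc k                   ∎)

  nilpotent⇒[1-x]-leftInvertible : ∀ {x} k → x ^ k ≡ 0# → ∃ λ g → g * (1# - x) ≡ 1#
  nilpotent⇒[1-x]-leftInvertible {x} k xᵏ≡0 with geometric-series x k
  ... | g , g[1-x]≡1-xᵏ = g , trans g[1-x]≡1-xᵏ (trans (cong (λ y → 1# - y) xᵏ≡0) (x-0≡x 1#))

  module _ (M : Subset size) (c : Elem R) where

    private
      M+Rc? : Decidable (λ x → ∃ λ r → x - r * c ∈ M)
      M+Rc? x = any? (λ r → x - r * c ∈? M)

    M+Rc : Subset size
    M+Rc = ⟦ M+Rc? ⟧

    ∈M+Rc⁻ : ∀ {x} → x ∈ M+Rc → ∃ λ r → x - r * c ∈ M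
    ∈M+Rc⁻ = ∈⟦⟧⁻ M+Rc?

    M⊆M+Rc : M ⊆ M+Rc
    M⊆M+Rc {x} x∈M = ∈⟦⟧⁺ M+Rc? (0# , subst (_∈ M) (sym x-0c≡x) x∈M)
      where
      x-0c≡x : x - 0# * c ≡ x
      x-0c≡x = trans (cong (λ y → x - y) (zeroˡ c)) (x-0≡x x)

    c∈M+Rc : IsLeftIdeal R M → c ∈ M+Rc
    c∈M+Rc (0∈M , _) = ∈⟦⟧⁺ M+Rc? (1# , subst (_∈ M) (sym c-1c≡0) 0∈M)
      where
      c-1c≡0 : c - 1# * c ≡ 0#
      c-1c≡0 = trans (cong (λ y → c - y) (*-identityˡ c)) (-‿inverseʳ c)

    M+Rc-isLeftIdeal : IsLeftIdeal R M → IsLeftIdeal R M+Rc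
    M+Rc-isLeftIdeal (0∈M , closed-+ , closed-*) = M⊆M+Rc 0∈M , closed-+′ , closed-*′
      where
      closed-+′ : ∀ x y → x ∈ M+Rc → y ∈ M+Rc → x + y ∈ M+Rc
      closed-+′ x y x∈ y∈ with ∈⟦⟧⁻ M+Rc? x∈ | ∈⟦⟧⁻ M+Rc? y∈
      ... | r , x-rc∈M | s , y-sc∈M = ∈⟦⟧⁺ M+Rc? (r + s , subst (_∈ M) regroup (closed-+ _ _ x-rc∈M y-sc∈M))
        where
        regroup : (x - r * c) + (y - s * c) ≡ (x + y) - (r + s) * c
        regroup = begin
          (x - r * c) + (y - s * c)        ≡⟨ interchange x (- (r * c)) y (- (s * c)) ⟩
          (x + y) + (- (r * c) - s * c)    ≡⟨ cong ((x + y) +_) (-‿+-comm (r * c) (s * c)) ⟩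
          (x + y) - (r * c + s * c)        ≡⟨ cong (λ z → (x + y) - z) (distribʳ c r s) ⟨
          (x + y) - (r + s) * c            ∎
      closed-*′ : ∀ t x → x ∈ M+Rc → t * x ∈ M+Rc
      closed-*′ t x x∈ with ∈⟦⟧⁻ M+Rc? x∈
      ... | r , x-rc∈M = ∈⟦⟧⁺ M+Rc? (t * r , subst (_∈ M) distribute (closed-* t _ x-rc∈M))
        where
        distribute : t * (x - r * c) ≡ t * x - t * r * c
        distribute = trans (x[y-z]≈xy-xz t x (r * c)) (cong (λ z → t * x - z) (sym (*-assoc t r c)))

  -- If c ∉ M then M + Rc = R by maximality, and 1 = m + r c with r c nilpotent makes m a unit.
  centralNilpotent⇒J : ∀ {c} k → Central c → c ^ k ≡ 0# → InJacobson R c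
  centralNilpotent⇒J {c} k c-central cᵏ≡0 M (M-ideal@(_ , _ , closed-*) , 1∉M , maxM) with 1# ∈? M+Rc M c
  ... | no  1∉M+Rc = maxM (M+Rc M c) (M+Rc-isLeftIdeal M c M-ideal) (M⊆M+Rc M c) 1∉M+Rc (c∈M+Rc M c M-ideal)
  ... | yes 1∈M+Rc = ⊥-elim (1∉M (1∈M (∈M+Rc⁻ M c 1∈M+Rc)))
    where
    [rc]ᵏ≡0 : ∀ r → (r * c) ^ k ≡ 0#
    [rc]ᵏ≡0 r = trans (*-^-central c-central r k) (trans (cong (r ^ k *_) cᵏ≡0) (zeroʳ (r ^ k)))
    1∈M : (∃ λ r → 1# - r * c ∈ M) → 1# ∈ M
    1∈M (r , 1-rc∈M) = let g , g[1-rc]≡1 = nilpotent⇒[1-x]-leftInvertible k ([rc]ᵏ≡0 r)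
                       in subst (_∈ M) g[1-rc]≡1 (closed-* g _ 1-rc∈M)

  Γ′⇔Γ : InJacobson R two → ∀ x y → UnitGraphAdj R x y ⇔ CayleyAdj R x y
  Γ′⇔Γ two∈J x y = mk⇔ (λ (x≢y , unit) → x≢y , Equivalence.to (two∈J⇒isUnit-+⇔- two∈J x y) unit)
                       (λ (x≢y , unit) → x≢y , Equivalence.from (two∈J⇒isUnit-+⇔- two∈J x y) unit)

  -- The unit graph when 2 is a unit

  Γ′ : Elem R → Elem R → Set
  Γ′ = UnitGraphAdj R

  -‿adjacent : ∀ {x y} → Γ′ x y → Γ′ (- x) (- y)
  -‿adjacent {x} {y} (x≢y , x+y-unit) = x≢y ∘ -‿injective , subst (IsUnit R) (sym (-‿+-comm x y)) (-‿isUnit x+y-unit)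

  -‿nonadjacent : ∀ x → ¬ Γ′ x (- x)
  -‿nonadjacent x (_ , x-x-unit) = 0-notUnit (subst (IsUnit R) (-‿inverseʳ x) x-x-unit)

  Γ′-irreflexive : ∀ x → ¬ Γ′ x x
  Γ′-irreflexive x (x≢x , _) = x≢x refl

  two-isUnit⇒-x≡x⇒x≡0 : IsUnit R two → ∀ {x} → - x ≡ x → x ≡ 0#
  two-isUnit⇒-x≡x⇒x≡0 (v , _ , v*two≡1) {x} -x≡x = begin
    x                ≡⟨ *-identityˡ x ⟨
    1# * x           ≡⟨ cong (_* x) v*two≡1 ⟨
    v * two * x      ≡⟨ *-assoc v two x ⟩
    v * (two * x)    ≡⟨ cong (v *_) (two*x≡x+x x) ⟩
    v * (x + x)      ≡⟨ cong (λ y → v * (x + y)) -x≡x ⟨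
    v * (x - x)      ≡⟨ cong (v *_) (-‿inverseʳ x) ⟩
    v * 0#           ≡⟨ zeroʳ v ⟩
    0#               ∎

  two-isUnit⇒¬wellCovered : IsUnit R two → ¬ WellCovered Γ′
  two-isUnit⇒¬wellCovered two-unit wc =
    maximal-extension InvariantIndependent (orbit-invariantIndependent 0#) λ (M₀ , ⟨0⟩⊆M₀ , M₀-maximal) →
    maximal-extension InvariantIndependent (orbit-invariantIndependent 1#) λ (M₁ , ⟨1⟩⊆M₁ , M₁-maximal) →
    different-parity M₀-maximal M₁-maximal (⟨0⟩⊆M₀ (x∈saturation 0#)) (⟨1⟩⊆M₁ (x∈saturation 1#))
      (wc M₁ M₀ (invariant-maximal⇒maximal M₁-maximal) (invariant-maximal⇒maximal M₀-maximal))
    where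
    open Involution {Adj = Γ′} -‿involutive -‿adjacent -‿nonadjacent
    InvariantIndependent : Subset size → Set
    InvariantIndependent S = IsIndependent Γ′ S × Invariant -_ S
    orbit-invariantIndependent : ∀ x → InvariantIndependent (saturation ⁅ x ⁆)
    orbit-invariantIndependent x = saturation-⁅⁆-independent (Γ′-irreflexive x) , saturation-invariant ⁅ x ⁆
    x∈saturation : ∀ x → x ∈ saturation ⁅ x ⁆
    x∈saturation x = x∈p∪q⁺ (inj₁ (x∈⁅x⁆ x))
    onlyFixed : ∀ {S x} → x ∈ S → - x ≡ x → x ≡ 0#
    onlyFixed _ = two-isUnit⇒-x≡x⇒x≡0 two-unit
    different-parity : ∀ {M₀ M₁} → Maximal InvariantIndependent M₀ → Maximal InvariantIndependent M₁ →
                       0# ∈ M₀ → 1# ∈ M₁ → ∣ M₁ ∣ ≢ ∣ M₀ ∣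
    different-parity {M₀} {M₁} ((_ , σM₀) , _) ((indepM₁ , σM₁) , _) 0∈M₀ 1∈M₁ ∣M₁∣≡∣M₀∣ =
      let c₀ , ∣M₀∣≡odd = ∣invariant∣-odd -‿involutive σM₀ onlyFixed 0∈M₀ -0#≈0#
          c₁ , ∣M₁∣≡even = ∣invariant∣-even -‿involutive σM₁ onlyFixed 0∉M₁
      in ℕ.even≢odd c₁ c₀ (trans (sym ∣M₁∣≡even) (trans ∣M₁∣≡∣M₀∣ ∣M₀∣≡odd))
      where
      0∉M₁ : 0# ∉ M₁
      0∉M₁ 0∈M₁ = indepM₁ 0# 1# 0∈M₁ 1∈M₁ (1≢0 ∘ sym , subst (IsUnit R) (sym (+-identityˡ 1#)) 1-isUnit)

  ker : Elem R → Subset size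
  ker c = preimage (c *_) ⁅ 0# ⁆

  module _ {c x : Elem R} where

    ∈ker⁺ : c * x ≡ 0# → x ∈ ker c
    ∈ker⁺ cx≡0 = ∈-preimage⁺ (subst (_∈ ⁅ 0# ⁆) (sym cx≡0) (x∈⁅x⁆ 0#))

    ∈ker⁻ : x ∈ ker c → c * x ≡ 0#
    ∈ker⁻ x∈ = x∈⁅y⁆⇒x≡y 0# (∈-preimage⁻ x∈)

  ∣preimage-+∣ : ∀ y S → ∣ preimage (_+ y) S ∣ ≡ ∣ S ∣
  ∣preimage-+∣ y = ∣preimage∣-permutation (permutation (_+ y) (_- y) (λ x → x-y+y≡x x y) (λ x → x+y-y≡x x y))

  ∣fibre∣≡∣ker∣ : ∀ {c y} → c * y ≡ y → ∣ preimage (c *_) ⁅ y ⁆ ∣ ≡ ∣ ker c ∣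
  ∣fibre∣≡∣ker∣ {c} {y} cy≡y = trans (cong ∣_∣ (⊆-antisym shift unshift)) (∣preimage-+∣ (- y) (ker c))
    where
    c[x-y]≡cx-y : ∀ x → c * (x - y) ≡ c * x - y
    c[x-y]≡cx-y x = trans (x[y-z]≈xy-xz c x y) (cong (λ z → c * x - z) cy≡y)
    shift : preimage (c *_) ⁅ y ⁆ ⊆ preimage (_- y) (ker c)
    shift {x} x∈ = ∈-preimage⁺ (∈ker⁺ (trans (c[x-y]≡cx-y x)
      (trans (cong (_- y) (x∈⁅y⁆⇒x≡y y (∈-preimage⁻ x∈))) (-‿inverseʳ y))))
    unshift : preimage (_- y) (ker c) ⊆ preimage (c *_) ⁅ y ⁆
    unshift {x} x∈ = ∈-preimage⁺ (subst (_∈ ⁅ y ⁆) (sym cx≡y) (x∈⁅x⁆ y))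
      where
      cx≡y : c * x ≡ y
      cx≡y = x∙y⁻¹≈ε⇒x≈y (c * x) y (trans (sym (c[x-y]≡cx-y x)) (∈ker⁻ (∈-preimage⁻ x∈)))

  ∣preimage-*∣ : ∀ {c K} → (∀ {k} → k ∈ K → c * k ≡ k) → ∣ preimage (c *_) K ∣ ≡ ∣ K ∣ ℕ.* ∣ ker c ∣
  ∣preimage-*∣ {c} {K} fixed = ∣preimage∣-constantFibres (c *_) K (∣fibre∣≡∣ker∣ ∘ fixed)

  IsAdditiveSubgroup : Subset size → Set
  IsAdditiveSubgroup G = 0# ∈ G × (∀ {x y} → x ∈ G → y ∈ G → x + y ∈ G) × (∀ {x} → x ∈ G → - x ∈ G)

  ker-isAdditiveSubgroup : ∀ c → IsAdditiveSubgroup (ker c)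
  ker-isAdditiveSubgroup c =
      ∈ker⁺ (zeroʳ c)
    , (λ x∈ y∈ → ∈ker⁺ (trans (distribˡ c _ _) (trans (cong₂ _+_ (∈ker⁻ x∈) (∈ker⁻ y∈)) (+-identityˡ 0#))))
    , (λ x∈ → ∈ker⁺ (trans (sym (-‿distribʳ-* c _)) (trans (cong -_ (∈ker⁻ x∈)) -0#≈0#)))

  ⁅0⁆-isAdditiveSubgroup : IsAdditiveSubgroup ⁅ 0# ⁆
  ⁅0⁆-isAdditiveSubgroup = x∈⁅x⁆ 0# , +-closed , -‿closed
    where
    +-closed : ∀ {x y} → x ∈ ⁅ 0# ⁆ → y ∈ ⁅ 0# ⁆ → x + y ∈ ⁅ 0# ⁆
    +-closed x∈ y∈ rewrite x∈⁅y⁆⇒x≡y 0# x∈ | x∈⁅y⁆⇒x≡y 0# y∈ =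
      subst (_∈ ⁅ 0# ⁆) (sym (+-identityˡ 0#)) (x∈⁅x⁆ 0#)
    -‿closed : ∀ {x} → x ∈ ⁅ 0# ⁆ → - x ∈ ⁅ 0# ⁆
    -‿closed x∈ rewrite x∈⁅y⁆⇒x≡y 0# x∈ = subst (_∈ ⁅ 0# ⁆) (sym -0#≈0#) (x∈⁅x⁆ 0#)

  module Doubling {H : Subset size} (H-subgroup : IsAdditiveSubgroup H)
                  {y : Elem R} (y∉H : y ∉ H) (y+y∈H : y + y ∈ H) where

    private
      0∈H : 0# ∈ H
      0∈H = proj₁ H-subgroup
      +-closed : ∀ {x z} → x ∈ H → z ∈ H → x + z ∈ H
      +-closed = proj₁ (proj₂ H-subgroup)
      -‿closed : ∀ {x} → x ∈ H → - x ∈ H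
      -‿closed = proj₂ (proj₂ H-subgroup)

    H+y : Subset size
    H+y = preimage (_- y) H

    H∪H+y-isAdditiveSubgroup : IsAdditiveSubgroup (H ∪ H+y)
    H∪H+y-isAdditiveSubgroup = x∈p∪q⁺ (inj₁ 0∈H) , +-closed′ , -‿closed′
      where
      +-closed′ : ∀ {u v} → u ∈ H ∪ H+y → v ∈ H ∪ H+y → u + v ∈ H ∪ H+y
      +-closed′ {u} {v} u∈ v∈ with x∈p∪q⁻ H H+y u∈ | x∈p∪q⁻ H H+y v∈
      ... | inj₁ u∈H   | inj₁ v∈H   = x∈p∪q⁺ (inj₁ (+-closed u∈H v∈H))
      ... | inj₁ u∈H   | inj₂ v∈H+y = x∈p∪q⁺ (inj₂ (∈-preimage⁺
            (subst (_∈ H) (sym (+-assoc u v (- y))) (+-closed u∈H (∈-preimage⁻ v∈H+y)))))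
      ... | inj₂ u∈H+y | inj₁ v∈H   = x∈p∪q⁺ (inj₂ (∈-preimage⁺
            (subst (_∈ H) (xy∙z≈xz∙y u (- y) v) (+-closed (∈-preimage⁻ u∈H+y) v∈H))))
      ... | inj₂ u∈H+y | inj₂ v∈H+y = x∈p∪q⁺ (inj₁ (subst (_∈ H) (x-y+y≡x (u + v) (y + y))
            (+-closed (subst (_∈ H) regroup (+-closed (∈-preimage⁻ u∈H+y) (∈-preimage⁻ v∈H+y))) y+y∈H)))
        where
        regroup : (u - y) + (v - y) ≡ (u + v) - (y + y)
        regroup = trans (interchange u (- y) v (- y)) (cong ((u + v) +_) (-‿+-comm y y))
      -‿closed′ : ∀ {u} → u ∈ H ∪ H+y → - u ∈ H ∪ H+y
      -‿closed′ {u} u∈ with x∈p∪q⁻ H H+y u∈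
      ... | inj₁ u∈H   = x∈p∪q⁺ (inj₁ (-‿closed u∈H))
      ... | inj₂ u∈H+y = x∈p∪q⁺ (inj₂ (∈-preimage⁺ (subst (_∈ H) (sym (-‿+-comm u y))
            (-‿closed (subst (_∈ H) ([x-y]+[y+y]≡x+y u y) (+-closed (∈-preimage⁻ u∈H+y) y+y∈H))))))

    ∣H∪H+y∣≡2*∣H∣ : ∣ H ∪ H+y ∣ ≡ 2 ℕ.* ∣ H ∣
    ∣H∪H+y∣≡2*∣H∣ = begin
      ∣ H ∪ H+y ∣          ≡⟨ ∣p∪q∣≡∣p∣+∣q∣ disjoint ⟩
      ∣ H ∣ ℕ.+ ∣ H+y ∣    ≡⟨ cong (∣ H ∣ ℕ.+_) (∣preimage-+∣ (- y) H) ⟩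
      ∣ H ∣ ℕ.+ ∣ H ∣      ≡⟨ cong (∣ H ∣ ℕ.+_) (ℕ.+-identityʳ ∣ H ∣) ⟨
      2 ℕ.* ∣ H ∣          ∎
      where
      disjoint : ∀ {x} → x ∈ H → x ∉ H+y
      disjoint {x} x∈H x-y∈H = y∉H (subst (_∈ H) (x-[x-y]≡y x y) (+-closed x∈H (-‿closed (∈-preimage⁻ x-y∈H))))

    ∣H∣<∣H∪H+y∣ : ∣ H ∣ ℕ.< ∣ H ∪ H+y ∣
    ∣H∣<∣H∪H+y∣ = p⊂q⇒∣p∣<∣q∣ ((λ x∈H → x∈p∪q⁺ (inj₁ x∈H)) , y , y∈H∪H+y , y∉H)
      where
      y∈H∪H+y : y ∈ H ∪ H+y
      y∈H∪H+y = x∈p∪q⁺ (inj₂ (∈-preimage⁺ (subst (_∈ H) (sym (-‿inverseʳ y)) 0∈H)))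

  module _ {G : Subset size} (G-subgroup : IsAdditiveSubgroup G) where

    private
      +-closed : ∀ {x z} → x ∈ G → z ∈ G → x + z ∈ G
      +-closed = proj₁ (proj₂ G-subgroup)

    last-doubling-outside : ∀ {H} j {z} → z ∈ G → z ∉ H → two ^ j * z ∈ H → ∃ λ y → y ∈ G × y ∉ H × y + y ∈ H
    last-doubling-outside {H} zero    {z} _   z∉H z∈H = ⊥-elim (z∉H (subst (_∈ H) (*-identityˡ z) z∈H))
    last-doubling-outside {H} (suc j) {z} z∈G z∉H 2ʲ⁺¹z∈H with z + z ∈? H
    ... | yes z+z∈H = z , z∈G , z∉H , z+z∈H
    ... | no  z+z∉H = last-doubling-outside j (+-closed z∈G z∈G) z+z∉H (subst (_∈ H) reassociate 2ʲ⁺¹z∈H)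
      where
      reassociate : two ^ suc j * z ≡ two ^ j * (z + z)
      reassociate = begin
        two * two ^ j * z      ≡⟨ cong (_* z) (x*x^k≡x^k*x two j) ⟩
        two ^ j * two * z      ≡⟨ *-assoc (two ^ j) two z ⟩
        two ^ j * (two * z)    ≡⟨ cong (two ^ j *_) (two*x≡x+x z) ⟩
        two ^ j * (z + z)      ∎

    -- Grow a subgroup H ⊆ G of order 2ᵐ by the coset of an element y ∉ H with 2 y ∈ H.
    ∣subgroup∣≡2^ : ∀ k → (∀ {x} → x ∈ G → two ^ k * x ≡ 0#) → ∃ λ m → ∣ G ∣ ≡ 2 ℕ.^ m
    ∣subgroup∣≡2^ k torsion = grow ⁅ 0# ⁆ ⁅0⁆-isAdditiveSubgroup ⁅0⁆⊆G (0 , ∣⁅x⁆∣≡1 0#) (<-wellFounded _)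
      where
      ⁅0⁆⊆G : ⁅ 0# ⁆ ⊆ G
      ⁅0⁆⊆G x∈⁅0⁆ = subst (_∈ G) (sym (x∈⁅y⁆⇒x≡y 0# x∈⁅0⁆)) (proj₁ G-subgroup)
      grow : ∀ H → IsAdditiveSubgroup H → H ⊆ G → ∃ (λ m → ∣ H ∣ ≡ 2 ℕ.^ m) → Acc ℕ._<_ (size ℕ.∸ ∣ H ∣) →
             ∃ λ m → ∣ G ∣ ≡ 2 ℕ.^ m
      grow H H-subgroup H⊆G (m , ∣H∣≡2ᵐ) (acc rec) with any? (λ z → z ∈? G ×-dec ¬? (z ∈? H))
      ... | no  G⊈H = m , trans (cong ∣_∣ (⊆-antisym G⊆H H⊆G)) ∣H∣≡2ᵐ
        where
        G⊆H : G ⊆ H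
        G⊆H {z} z∈G = decidable-stable (z ∈? H) (λ z∉H → G⊈H (z , z∈G , z∉H))
      ... | yes (z , z∈G , z∉H)
          with last-doubling-outside k z∈G z∉H (subst (_∈ H) (sym (torsion z∈G)) (proj₁ H-subgroup))
      ...   | y , y∈G , y∉H , y+y∈H =
        grow (H ∪ H+y) H∪H+y-isAdditiveSubgroup H∪H+y⊆G (suc m , trans ∣H∪H+y∣≡2*∣H∣ (cong (2 ℕ.*_) ∣H∣≡2ᵐ))
             (rec (ℕ.∸-monoʳ-< ∣H∣<∣H∪H+y∣ (∣p∣≤n (H ∪ H+y))))
        where
        open Doubling H-subgroup y∉H y+y∈H
        H∪H+y⊆G : H ∪ H+y ⊆ G
        H∪H+y⊆G {x} x∈ with x∈p∪q⁻ H H+y x∈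
        ... | inj₁ x∈H   = H⊆G x∈H
        ... | inj₂ x∈H+y = subst (_∈ G) (x-y+y≡x x y) (+-closed (H⊆G (∈-preimage⁻ x∈H+y)) y∈G)

  -- Splitting along a central idempotent

  module _ {e : Elem R} (e-central : Central e) (e-idem : e * e ≡ e) where

    1-central : Central (1# - e)
    1-central x = begin
      (1# - e) * x        ≡⟨ [y-z]x≈yx-zx x 1# e ⟩
      1# * x - e * x      ≡⟨ cong₂ (λ a b → a - b) (*-identityˡ x) (e-central x) ⟩
      x - x * e           ≡⟨ cong (λ a → a - x * e) (*-identityʳ x) ⟨
      x * 1# - x * e      ≡⟨ x[y-z]≈xy-xz x 1# e ⟨
      x * (1# - e)        ∎

    e*[1-e]≡0 : e * (1# - e) ≡ 0#
    e*[1-e]≡0 = trans (x[y-z]≈xy-xz e 1# e) (trans (cong₂ (λ a b → a - b) (*-identityʳ e) e-idem) (-‿inverseʳ e))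

    1-idem : (1# - e) * (1# - e) ≡ 1# - e
    1-idem = begin
      (1# - e) * (1# - e)               ≡⟨ x[y-z]≈xy-xz (1# - e) 1# e ⟩
      (1# - e) * 1# - (1# - e) * e
        ≡⟨ cong₂ (λ a b → a - b) (*-identityʳ (1# - e)) (trans (sym (e-central (1# - e))) e*[1-e]≡0) ⟩
      (1# - e) - 0#                     ≡⟨ x-0≡x (1# - e) ⟩
      1# - e                            ∎

    e+[1-e]≡1 : e + (1# - e) ≡ 1#
    e+[1-e]≡1 = trans (+-comm e (1# - e)) (x-y+y≡x 1# e)

  module Complementary {c d : Elem R} (c-central : Central c) (d-central : Central d)
                       (c-idem : c * c ≡ c) (d-idem : d * d ≡ d) (cd≡0 : c * d ≡ 0#) (c+d≡1 : c + d ≡ 1#) where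

    cx+dx≡x : ∀ x → c * x + d * x ≡ x
    cx+dx≡x x = trans (sym (distribʳ x c d)) (trans (cong (_* x) c+d≡1) (*-identityˡ x))

    dx≡0⇒cx≡x : ∀ {x} → d * x ≡ 0# → c * x ≡ x
    dx≡0⇒cx≡x {x} dx≡0 = trans (sym (+-identityʳ (c * x))) (trans (cong (c * x +_) (sym dx≡0)) (cx+dx≡x x))

    c[dx]≡0 : ∀ x → c * (d * x) ≡ 0#
    c[dx]≡0 x = trans (sym (*-assoc c d x)) (trans (cong (_* x) cd≡0) (zeroˡ x))

    d[cx]≡0 : ∀ x → d * (c * x) ≡ 0#
    d[cx]≡0 x = trans (sym (*-assoc d c x)) (trans (cong (_* x) (trans (d-central c) cd≡0)) (zeroˡ x))

    cx*cy≡c[xy] : ∀ x y → c * x * (c * y) ≡ c * (x * y)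
    cx*cy≡c[xy] x y = begin
      c * x * (c * y)    ≡⟨ *-assoc c x (c * y) ⟩
      c * (x * (c * y))  ≡⟨ cong (c *_) (*-assoc x c y) ⟨
      c * (x * c * y)    ≡⟨ cong (λ w → c * (w * y)) (c-central x) ⟨
      c * (c * x * y)    ≡⟨ cong (c *_) (*-assoc c x y) ⟩
      c * (c * (x * y))  ≡⟨ *-assoc c c (x * y) ⟨
      c * c * (x * y)    ≡⟨ cong (_* (x * y)) c-idem ⟩
      c * (x * y)        ∎

    component-* : ∀ x y → (c * x + d) * (c * y + d) ≡ c * (x * y) + d
    component-* x y = begin
      (c * x + d) * (c * y + d)
        ≡⟨ distribˡ (c * x + d) (c * y) d ⟩
      (c * x + d) * (c * y) + (c * x + d) * d
        ≡⟨ cong₂ _+_ (distribʳ (c * y) (c * x) d) (distribʳ d (c * x) d) ⟩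
      (c * x * (c * y) + d * (c * y)) + (c * x * d + d * d)
        ≡⟨ cong₂ (λ a b → (a + d * (c * y)) + (b + d * d)) (cx*cy≡c[xy] x y) cx*d≡0 ⟩
      (c * (x * y) + d * (c * y)) + (0# + d * d)
        ≡⟨ cong₂ (λ a b → (c * (x * y) + a) + b) (d[cx]≡0 y) (+-identityˡ (d * d)) ⟩
      (c * (x * y) + 0#) + d * d
        ≡⟨ cong₂ _+_ (+-identityʳ (c * (x * y))) d-idem ⟩
      c * (x * y) + d
        ∎
      where
      cx*d≡0 : c * x * d ≡ 0#
      cx*d≡0 = trans (*-assoc c x d) (trans (cong (c *_) (sym (d-central x))) (c[dx]≡0 x))

    component-inverse : ∀ {x y} → c * (x * y) ≡ c → (c * x + d) * (c * y + d) ≡ 1#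
    component-inverse {x} {y} c[xy]≡c = trans (component-* x y) (trans (cong (_+ d) c[xy]≡c) c+d≡1)

    component-isUnit : ∀ {u} → IsUnit R u → IsUnit R (c * u + d)
    component-isUnit {u} (v , uv≡1 , vu≡1) = c * v + d
      , component-inverse (trans (cong (c *_) uv≡1) (*-identityʳ c))
      , component-inverse (trans (cong (c *_) vu≡1) (*-identityʳ c))

    lift : Elem R → Elem R → Elem R
    lift k z = k + (d - d * z)

    c*lift : ∀ {k} z → d * k ≡ 0# → c * lift k z ≡ k
    c*lift {k} z dk≡0 = begin
      c * (k + (d - d * z))           ≡⟨ distribˡ c k (d - d * z) ⟩
      c * k + c * (d - d * z)         ≡⟨ cong₂ _+_ (dx≡0⇒cx≡x dk≡0) (x[y-z]≈xy-xz c d (d * z)) ⟩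
      k + (c * d - c * (d * z))       ≡⟨ cong₂ (λ a b → k + (a - b)) cd≡0 (c[dx]≡0 z) ⟩
      k + (0# - 0#)                   ≡⟨ cong (k +_) (-‿inverseʳ 0#) ⟩
      k + 0#                          ≡⟨ +-identityʳ k ⟩
      k                               ∎

    z+lift : ∀ k z → z + lift k z ≡ k + c * z + d
    z+lift k z = begin
      z + (k + (d - d * z))                  ≡⟨ cong (_+ (k + (d - d * z))) (cx+dx≡x z) ⟨
      (c * z + d * z) + (k + (d - d * z))    ≡⟨ CM.solve 5 (λ a b x y w → (a ⊕ b) ⊕ (x ⊕ (y ⊕ w)) ⊜ ((x ⊕ a) ⊕ y) ⊕ (b ⊕ w))
                                                   refl (c * z) (d * z) k d (- (d * z)) ⟩
      (k + c * z + d) + (d * z - d * z)      ≡⟨ cong ((k + c * z + d) +_) (-‿inverseʳ (d * z)) ⟩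
      (k + c * z + d) + 0#                   ≡⟨ +-identityʳ (k + c * z + d) ⟩
      k + c * z + d                          ∎

    -- K ⊆ cR is independent in Γ′(cR) with loops counted: k + k' + d is a unit iff k + k' is one in cR.
    Admissible : Subset size → Set
    Admissible K = K ⊆ ker d × (∀ {k k'} → k ∈ K → k' ∈ K → ¬ IsUnit R (k + k' + d))

    ⁅0⁆-admissible : ¬ IsUnit R d → Admissible ⁅ 0# ⁆
    ⁅0⁆-admissible d-nonunit = ⊆ker , independent
      where
      ⊆ker : ⁅ 0# ⁆ ⊆ ker d
      ⊆ker x∈ = subst (_∈ ker d) (sym (x∈⁅y⁆⇒x≡y 0# x∈)) (∈ker⁺ (zeroʳ d))
      independent : ∀ {k k'} → k ∈ ⁅ 0# ⁆ → k' ∈ ⁅ 0# ⁆ → ¬ IsUnit R (k + k' + d)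
      independent k∈ k'∈ rewrite x∈⁅y⁆⇒x≡y 0# k∈ | x∈⁅y⁆⇒x≡y 0# k'∈ =
        d-nonunit ∘ subst (IsUnit R) (trans (cong (_+ d) (+-identityˡ 0#)) (+-identityˡ d))

    ∣preimage-admissible∣ : ∀ {K} → Admissible K → ∣ preimage (c *_) K ∣ ≡ ∣ K ∣ ℕ.* ∣ ker c ∣
    ∣preimage-admissible∣ (K⊆ker , _) = ∣preimage-*∣ (λ k∈K → dx≡0⇒cx≡x (∈ker⁻ (K⊆ker k∈K)))

    module _ (halve : ∀ {a} → d * a ≡ 0# → IsUnit R (a + a + d) → IsUnit R (a + d)) where

      preimage-maximalIndependent : ∀ {K} → 0# ∈ K → Maximal Admissible K →
                                    IsMaximalIndependent Γ′ (preimage (c *_) K)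
      preimage-maximalIndependent {K} 0∈K ((K⊆ker , K-indep) , K-maximal) = independent , maximal
        where
        independent : IsIndependent Γ′ (preimage (c *_) K)
        independent x y x∈ y∈ (_ , x+y-unit) = K-indep (∈-preimage⁻ x∈) (∈-preimage⁻ y∈)
          (subst (IsUnit R) (cong (_+ d) (distribˡ c x y)) (component-isUnit x+y-unit))
        maximal : ∀ T → IsIndependent Γ′ T → preimage (c *_) K ⊆ T → T ⊆ preimage (c *_) K
        maximal T T-indep S⊆T {z} z∈T with c * z ∈? K
        ... | yes cz∈K = ∈-preimage⁺ cz∈K
        ... | no  cz∉K =
          ⊥-elim (cz∉K (K-maximal K′ (K′⊆ker , K′-indep) (x∈p∪q⁺ ∘ inj₁) (x∈p∪q⁺ (inj₂ (x∈⁅x⁆ (c * z))))))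
          where
          K′ : Subset size
          K′ = K ∪ ⁅ c * z ⁆
          ∈K′⁻ : ∀ {w} → w ∈ K′ → w ∈ K ⊎ w ≡ c * z
          ∈K′⁻ w∈ with x∈p∪q⁻ K _ w∈
          ... | inj₁ w∈K    = inj₁ w∈K
          ... | inj₂ w∈⁅cz⁆ = inj₂ (x∈⁅y⁆⇒x≡y (c * z) w∈⁅cz⁆)
          -- otherwise z would be adjacent to lift k z ∈ preimage (c *_) K
          blocked : ∀ {k} → k ∈ K → ¬ IsUnit R (k + c * z + d)
          blocked {k} k∈K unit = T-indep z (lift k z) z∈T (S⊆T (∈-preimage⁺ (subst (_∈ K) (sym c*lift≡k) k∈K)))
                                   (z≢lift , subst (IsUnit R) (sym (z+lift k z)) unit)
            where
            c*lift≡k : c * lift k z ≡ k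
            c*lift≡k = c*lift z (∈ker⁻ (K⊆ker k∈K))
            z≢lift : z ≢ lift k z
            z≢lift z≡lift = cz∉K (subst (_∈ K) (sym (trans (cong (c *_) z≡lift) c*lift≡k)) k∈K)
          K′⊆ker : K′ ⊆ ker d
          K′⊆ker w∈ with ∈K′⁻ w∈
          ... | inj₁ w∈K  = K⊆ker w∈K
          ... | inj₂ refl = ∈ker⁺ (d[cx]≡0 z)
          K′-indep : ∀ {w w′} → w ∈ K′ → w′ ∈ K′ → ¬ IsUnit R (w + w′ + d)
          K′-indep w∈ w′∈ with ∈K′⁻ w∈ | ∈K′⁻ w′∈
          ... | inj₁ w∈K  | inj₁ w′∈K = K-indep w∈K w′∈K
          ... | inj₁ w∈K  | inj₂ refl = blocked w∈K
          ... | inj₂ refl | inj₁ w′∈K = blocked w′∈K ∘ subst (IsUnit R) (cong (_+ d) (+-comm (c * z) _))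
          ... | inj₂ refl | inj₂ refl = blocked 0∈K ∘ subst (IsUnit R) (cong (_+ d) (sym (+-identityˡ (c * z))))
                                                    ∘ halve (d[cx]≡0 z)

  -- A nontrivial idempotent power of 2; here ker f = eR and ker e = fR

  module _ {N : ℕ} (e-idem : two ^ suc N * two ^ suc N ≡ two ^ suc N) where

    private
      t e f : Elem R
      t = two ^ N
      e = two ^ suc N
      f = 1# - e

      e-central : Central e
      e-central = ^-central two-central (suc N)

      f-idem : f * f ≡ f
      f-idem = 1-idem e-central e-idem

      ef≡0 : e * f ≡ 0#
      ef≡0 = e*[1-e]≡0 e-central e-idem

      fe≡0 : f * e ≡ 0#
      fe≡0 = trans (sym (e-central f)) ef≡0

      e+f≡1 : e + f ≡ 1#
      e+f≡1 = e+[1-e]≡1 e-central e-idem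

    module E = Complementary e-central (1-central e-central e-idem) e-idem f-idem ef≡0 e+f≡1
    module F = Complementary (1-central e-central e-idem) e-central f-idem e-idem fe≡0 (trans (+-comm f e) e+f≡1)

    private
      e[t*two]≡e : e * (t * two) ≡ e
      e[t*two]≡e = trans (cong (e *_) (sym (two-central t))) e-idem

      et+f-isUnit : IsUnit R (e * t + f)
      et+f-isUnit = e * two + f , E.component-inverse e[t*two]≡e , E.component-inverse e-idem

      e2+f-isUnit : IsUnit R (e * two + f)
      e2+f-isUnit = e * t + f , E.component-inverse e-idem , E.component-inverse e[t*two]≡e

    halve : ∀ {a} → f * a ≡ 0# → IsUnit R (a + a + f) → IsUnit R (a + f)
    halve {a} fa≡0 a+a+f-unit = subst (IsUnit R) [et+f][a+a+f]≡a+f (*-isUnit et+f-isUnit a+a+f-unit)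
      where
      ea≡a : e * a ≡ a
      ea≡a = E.dx≡0⇒cx≡x fa≡0
      e[two*a]≡a+a : e * (two * a) ≡ a + a
      e[two*a]≡a+a = trans (cong (e *_) (two*x≡x+x a)) (trans (distribˡ e a a) (cong₂ _+_ ea≡a ea≡a))
      [et+f][a+a+f]≡a+f : (e * t + f) * (a + a + f) ≡ a + f
      [et+f][a+a+f]≡a+f = begin
        (e * t + f) * (a + a + f)            ≡⟨ cong (λ b → (e * t + f) * (b + f)) e[two*a]≡a+a ⟨
        (e * t + f) * (e * (two * a) + f)    ≡⟨ E.component-* t (two * a) ⟩
        e * (t * (two * a)) + f              ≡⟨ cong (λ b → e * b + f) (*-assoc t two a) ⟨
        e * (t * two * a) + f                ≡⟨ cong (_+ f) (*-assoc e (t * two) a) ⟨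
        e * (t * two) * a + f                ≡⟨ cong (λ b → b * a + f) e[t*two]≡e ⟩
        e * a + f                            ≡⟨ cong (_+ f) ea≡a ⟩
        a + f                                ∎

    -- f = 2 w would give f = f ^ (N + 1) = w ^ (N + 1) e, which f annihilates.
    double-nonunit : e ≢ 1# → ∀ {a} → e * a ≡ 0# → ¬ IsUnit R (a + a + e)
    double-nonunit e≢1 {a} ea≡0 (v , [a+a+e]v≡1 , _) = e≢1 (begin
      e         ≡⟨ +-identityʳ e ⟨
      e + 0#    ≡⟨ cong (e +_) f≡0 ⟨
      e + f     ≡⟨ e+f≡1 ⟩
      1#        ∎)
      where
      w : Elem R
      w = a * v
      fa≡a : f * a ≡ a
      fa≡a = F.dx≡0⇒cx≡x ea≡0
      f≡w*two : f ≡ w * two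
      f≡w*two = begin
        f                          ≡⟨ *-identityʳ f ⟨
        f * 1#                     ≡⟨ cong (f *_) [a+a+e]v≡1 ⟨
        f * ((a + a + e) * v)      ≡⟨ *-assoc f (a + a + e) v ⟨
        f * (a + a + e) * v        ≡⟨ cong (_* v) (distribˡ f (a + a) e) ⟩
        (f * (a + a) + f * e) * v  ≡⟨ cong₂ (λ b c → (b + c) * v) (trans (distribˡ f a a) (cong₂ _+_ fa≡a fa≡a)) fe≡0 ⟩
        (a + a + 0#) * v           ≡⟨ cong (_* v) (trans (+-identityʳ (a + a)) (sym (two*x≡x+x a))) ⟩
        two * a * v                ≡⟨ *-assoc two a v ⟩
        two * w                    ≡⟨ two-central w ⟩
        w * two                    ∎
      f≡0 : f ≡ 0#
      f≡0 = begin
        f                        ≡⟨ f-idem ⟨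
        f * f                    ≡⟨ cong (_* f) (idempotent-^ f-idem N) ⟨
        f ^ suc N * f            ≡⟨ cong (λ b → b ^ suc N * f) f≡w*two ⟩
        (w * two) ^ suc N * f    ≡⟨ cong (_* f) (*-^-central two-central w (suc N)) ⟩
        w ^ suc N * e * f        ≡⟨ *-assoc (w ^ suc N) e f ⟩
        w ^ suc N * (e * f)      ≡⟨ cong (w ^ suc N *_) ef≡0 ⟩
        w ^ suc N * 0#           ≡⟨ zeroʳ (w ^ suc N) ⟩
        0#                       ∎

    ∣ker-f∣-odd : ∃ λ c → ∣ ker f ∣ ≡ suc (2 ℕ.* c)
    ∣ker-f∣-odd =
      ∣invariant∣-odd -‿involutive (proj₂ (proj₂ (ker-isAdditiveSubgroup f))) onlyFixed (∈ker⁺ (zeroʳ f)) -0#≈0#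
      where
      onlyFixed : ∀ {x} → x ∈ ker f → - x ≡ x → x ≡ 0#
      onlyFixed {x} x∈ -x≡x = begin
        x                   ≡⟨ E.dx≡0⇒cx≡x (∈ker⁻ x∈) ⟨
        two * t * x         ≡⟨ cong (_* x) (two-central t) ⟩
        t * two * x         ≡⟨ *-assoc t two x ⟩
        t * (two * x)       ≡⟨ cong (t *_) (two*x≡x+x x) ⟩
        t * (x + x)         ≡⟨ cong (λ y → t * (x + y)) -x≡x ⟨
        t * (x - x)         ≡⟨ cong (t *_) (-‿inverseʳ x) ⟩
        t * 0#              ≡⟨ zeroʳ t ⟩
        0#                  ∎

    ∣ker-e∣-2^ : ∃ λ m → ∣ ker e ∣ ≡ 2 ℕ.^ m
    ∣ker-e∣-2^ = ∣subgroup∣≡2^ (ker-isAdditiveSubgroup e) (suc N) ∈ker⁻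

    ∣ker-f∣∤∣admissible∣*∣ker-e∣ : ∀ {K} → E.Admissible K → 0# ∈ K →
                                  ¬ (∣ ker f ∣ ∣ ∣ K ∣ ℕ.* ∣ ker e ∣)
    ∣ker-f∣∤∣admissible∣*∣ker-e∣ {K} (K⊆ker , K-indep) 0∈K divides-product =
      let m , ∣ker-e∣≡2ᵐ = ∣ker-e∣-2^
          c , ∣ker-f∣≡odd = ∣ker-f∣-odd
          ∣ker-f∣∣∣K∣ : ∣ ker f ∣ ∣ ∣ K ∣
          ∣ker-f∣∣∣K∣ = subst (_∣ ∣ K ∣) (sym ∣ker-f∣≡odd) (odd∣n*2^m⇒odd∣n c ∣ K ∣ m
                          (subst₂ (λ a b → a ∣ ∣ K ∣ ℕ.* b) ∣ker-f∣≡odd ∣ker-e∣≡2ᵐ divides-product))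
      in ℕ.<⇒≱ ∣K∣<∣ker-f∣ (∣⇒≤ {{>-nonZero 0<∣K∣}} ∣ker-f∣∣∣K∣)
      where
      e∉K : e ∉ K
      e∉K e∈K = K-indep e∈K e∈K (subst (IsUnit R) (cong (_+ f) (x*two≡x+x e)) e2+f-isUnit)
      ∣K∣<∣ker-f∣ : ∣ K ∣ ℕ.< ∣ ker f ∣
      ∣K∣<∣ker-f∣ = p⊂q⇒∣p∣<∣q∣ (K⊆ker , e , ∈ker⁺ fe≡0 , e∉K)
      0<∣K∣ : 0 ℕ.< ∣ K ∣
      0<∣K∣ = subst (ℕ._≤ ∣ K ∣) (∣⁅x⁆∣≡1 0#)
                (p⊆q⇒∣p∣≤∣q∣ (λ x∈⁅0⁆ → subst (_∈ K) (sym (x∈⁅y⁆⇒x≡y 0# x∈⁅0⁆)) 0∈K))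

    nontrivialIdempotent⇒¬wellCovered : e ≢ 0# → e ≢ 1# → ¬ WellCovered Γ′
    nontrivialIdempotent⇒¬wellCovered e≢0 e≢1 wc =
      maximal-extension E.Admissible (E.⁅0⁆-admissible f-nonunit) λ (K , ⟨0⟩⊆K , K-maximal) →
      maximal-extension F.Admissible (F.⁅0⁆-admissible e-nonunit) λ (L , ⟨0⟩⊆L , L-maximal) →
      ∣ker-f∣∤∣admissible∣*∣ker-e∣ (proj₁ K-maximal) (⟨0⟩⊆K (x∈⁅x⁆ 0#)) (divides ∣ L ∣ (begin
        ∣ K ∣ ℕ.* ∣ ker e ∣      ≡⟨ E.∣preimage-admissible∣ (proj₁ K-maximal) ⟨
        ∣ preimage (e *_) K ∣    ≡⟨ wc _ _ (E.preimage-maximalIndependent halve (⟨0⟩⊆K (x∈⁅x⁆ 0#)) K-maximal)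
                                           (F.preimage-maximalIndependent (λ ea≡0 → ⊥-elim ∘ double-nonunit e≢1 ea≡0)
                                                                          (⟨0⟩⊆L (x∈⁅x⁆ 0#)) L-maximal) ⟩
        ∣ preimage (f *_) L ∣    ≡⟨ F.∣preimage-admissible∣ (proj₁ L-maximal) ⟩
        ∣ L ∣ ℕ.* ∣ ker f ∣      ∎))
      where
      f-nonunit : ¬ IsUnit R f
      f-nonunit f-unit = e≢0 (+-cancelʳ 1# e 0# (begin
        e + 1#     ≡⟨ cong (e +_) (idempotent-isUnit⇒≡1 f-idem f-unit) ⟨
        e + f      ≡⟨ e+f≡1 ⟩
        1#         ≡⟨ +-identityˡ 1# ⟨
        0# + 1#    ∎))
      e-nonunit : ¬ IsUnit R e
      e-nonunit = e≢1 ∘ idempotent-isUnit⇒≡1 e-idem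

  wellCovered⇒two∈J : WellCovered Γ′ → InJacobson R two
  wellCovered⇒two∈J wc with idempotent-power two
  ... | N , e-idem with two ^ suc N ≟ᶠ 0#
  ...   | yes e≡0 = centralNilpotent⇒J (suc N) two-central e≡0
  ...   | no  e≢0 with two ^ suc N ≟ᶠ 1#
  ...     | yes e≡1 = ⊥-elim (two-isUnit⇒¬wellCovered (two ^ N , e≡1 , trans (sym (two-central (two ^ N))) e≡1) wc)
  ...     | no  e≢1 = ⊥-elim (nontrivialIdempotent⇒¬wellCovered {N} e-idem e≢0 e≢1 wc)

open Graphs using (wellCovered-resp-⇔)

theorem2p10 : (R : FiniteRing) →
    WellCovered (UnitGraphAdj R) ⇔ (WellCovered (CayleyAdj R) × CharRmodJIs2 R)
theorem2p10 R = mk⇔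
  (λ wc → let two∈J = wellCovered⇒two∈J wc
          in Equivalence.to (wellCovered-resp-⇔ (Γ′⇔Γ two∈J)) wc , two∈J , 1∉J)
  (λ (wc , two∈J , _) → Equivalence.from (wellCovered-resp-⇔ (Γ′⇔Γ two∈J)) wc)
  where open RingTheory R
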